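{- For $n\ge0$, let $\overline{\rho}(n)$ be the number of partitions of $n$ in which the largest part $\lambda$ (not overlined) appears exactly once and the remaining parts form an overpartition of $\lambda$; let $\overline{\rho}_o(n)$ be the same count but where the remaining parts form an overpartition of $\lambda$ into odd parts; and let $\overline{\rho}_e(n)$ be the same count but where the remaining parts form an overpartition of $\lambda$ into even parts. Then, as formal power series (equivalently for $|q|<1$), $$\sum_{n=0}^{\infty}\overline{\rho}(n)q^n=\frac{(q^{4};q^{4})_\infty}{(q^2;q^2)^2_\infty}-\frac{2}{1-q^2}+1,$$ $$\sum_{n=0}^{\infty}\overline{\rho}_o(n)q^n=\frac{(q^{4};q^{4})^3_\infty}{(q^2;q^2)^2_\infty(q^8;q^8)_\infty}-\frac{2q^2}{1-q^4}-1,$$ $$\sum_{n=0}^{\infty}\overline{\rho}_e(n)q^n=\frac{(q^{8};q^{8})_\infty}{(q^4;q^4)^2_\infty}-\frac{2q^4}{1-q^4}-1.$$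
   Context: For $|q|<1$, $(a;q)_\infty=\prod_{k=0}^{\infty}(1-aq^k)$. An overpartition of $m$ is a partition of $m$ in which the first occurrence of each part size may (or may not) be overlined; e.g. there are 14 overpartitions of 4. Since the largest part $\lambda$ appears exactly once, the remaining parts all have size strictly less than $\lambda$ (so in particular the overpartitions $\lambda$ and $\overline{\lambda}$ consisting of a single part are excluded), and $n=2\lambda$. The empty partition has no largest part, so all these counts are $0$ at $n=0$. -}

module Defs where

open import Data.Bool using (Bool; true; false; _∧_; _∨_; not; if_then_else_)
open import Data.Nat as ℕ using (ℕ; zero; suc; _∸_; _≡ᵇ_; _<ᵇ_; _≤ᵇ_; _%_)
open import Data.Integer as ℤ using (ℤ; +_; -_)
open import Data.List using (List; []; _∷_; map; concatMap; filterᵇ; length; applyUpTo)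
open import Data.Bool.ListAction using (and)
open import Data.Nat.ListAction using (sum)
open import Data.Product using (_×_; _,_; proj₁)

-- An overpartition is a list of (size , overlined?) pairs, listed with
-- sizes weakly decreasing; among equal sizes only the first occurrence
-- may be overlined.  This gives exactly
-- one list per overpartition.

Part : Set
Part = ℕ × Bool

all : {A : Set} → (A → Bool) → List A → Bool
all p xs = and (map p xs)

sizes : List Part → List ℕ
sizes = map proj₁

wellOrdered : List Part → Bool
wellOrdered [] = true
wellOrdered (_ ∷ []) = true
wellOrdered ((s₁ , b₁) ∷ (s₂ , b₂) ∷ r) =
  ((s₂ <ᵇ s₁) ∨ ((s₁ ≡ᵇ s₂) ∧ not b₂)) ∧ wellOrdered ((s₂ , b₂) ∷ r)

isOverpartitionOf : ℕ → List Part → Bool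
isOverpartitionOf m μ =
  (sum (sizes μ) ≡ᵇ m) ∧ all (λ p → 1 ≤ᵇ proj₁ p) μ ∧ wellOrdered μ

isOdd isEven : ℕ → Bool
isOdd k = (k % 2) ≡ᵇ 1
isEven k = (k % 2) ≡ᵇ 0

isOddOverpartitionOf : ℕ → List Part → Bool
isOddOverpartitionOf m μ = isOverpartitionOf m μ ∧ all (λ p → isOdd (proj₁ p)) μ

isEvenOverpartitionOf : ℕ → List Part → Bool
isEvenOverpartitionOf m μ = isOverpartitionOf m μ ∧ all (λ p → isEven (proj₁ p)) μ

isRhoObject : (ℕ → List Part → Bool) → ℕ → List Part → Bool
isRhoObject R n [] = false
isRhoObject R n ((λ′ , true) ∷ μ) = false
isRhoObject R n ((λ′ , false) ∷ μ) =
  (1 ≤ᵇ λ′) ∧ all (λ p → proj₁ p <ᵇ λ′) μ ∧ R λ′ μ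
  ∧ (λ′ ℕ.+ sum (sizes μ) ≡ᵇ n)

-- Finite pool of candidates: every list of length ≤ k over xs
-- (each such list occurs exactly once).
listsUpTo : {A : Set} → ℕ → List A → List (List A)
listsUpTo zero xs = [] ∷ []
listsUpTo (suc k) xs = [] ∷ concatMap (λ x → map (x ∷_) (listsUpTo k xs)) xs

partsUpTo : ℕ → List Part
partsUpTo n = concatMap (λ s → (s , true) ∷ (s , false) ∷ []) (applyUpTo suc n)

-- every (over)partition of n has ≤ n parts, each of size in 1..n
candidates : ℕ → List (List Part)
candidates n = listsUpTo n (partsUpTo n)

countRho : (ℕ → List Part → Bool) → ℕ → ℕ
countRho R n = length (filterᵇ (isRhoObject R n) (candidates n))

ρ̄ ρ̄ₒ ρ̄ₑ : ℕ → ℕ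
ρ̄ = countRho isOverpartitionOf
ρ̄ₒ = countRho isOddOverpartitionOf
ρ̄ₑ = countRho isEvenOverpartitionOf

Series : Set
Series = ℕ → ℤ

sumTo : ℕ → (ℕ → ℤ) → ℤ
sumTo zero f = f 0
sumTo (suc n) f = sumTo n f ℤ.+ f (suc n)

_⊕_ _⊖_ _⊗_ : Series → Series → Series
(f ⊕ g) n = f n ℤ.+ g n
(f ⊖ g) n = f n ℤ.- g n
(f ⊗ g) n = sumTo n (λ i → f i ℤ.* g (n ∸ i))

infixl 6 _⊕_ _⊖_
infixl 7 _⊗_

qpow : ℕ → Series
qpow k n = if n ≡ᵇ k then + 1 else + 0

𝟙 : Series
𝟙 = qpow 0

const : ℤ → Series
const c n = if n ≡ᵇ 0 then c else + 0

prodTo : ℕ → ℕ → Series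
prodTo a zero = 𝟙
prodTo a (suc m) = prodTo a m ⊗ (𝟙 ⊖ qpow (a ℕ.* suc m))

-- (q^a ; q^a)_∞ = ∏_{k≥1} (1 - q^{a k}).  For a ≥ 1 the coefficient of
-- q^n only depends on the factors with k ≤ n.
poch : ℕ → Series
poch a n = prodTo a n n

-- Multiplicative inverse of a series f with constant term 1:
-- b₀ = 1,  b_m = - Σ_{j<m} f_{m-j} b_j.
invUpTo : Series → ℕ → Series
invUpTo f zero i = if i ≡ᵇ 0 then + 1 else + 0
invUpTo f (suc n) i =
  if i ≡ᵇ suc n
  then - sumTo n (λ j → f (suc n ∸ j) ℤ.* invUpTo f n j)
  else invUpTo f n i

inv : Series → Series
inv f n = invUpTo f n n

gf : (ℕ → ℕ) → Series
gf c n = + (c n)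

-- A ρ̄-object of weight n is a non-overlined part λ with n = 2λ followed by an overpartition of λ
-- into parts below λ.  With Bₜ(m) the number of overpartitions of m into admissible parts below t,
-- the coefficient of q^{2λ} is B_λ(λ) = B_∞(λ) − 2[λ admissible]: the only overpartitions of λ
-- with a part ≥ λ are λ and λ̄.  Splitting off the first part gives Aₜ = Bₜ + qᵗAₜ (Aₜ: parts at
-- most t, none of them a t̄) and B_{t+1} = Bₜ + 2qᵗAₜ, so every admissible t multiplies the
-- generating function by (1 + qᵗ)/(1 − qᵗ) = (1 − q^{2t})/(1 − qᵗ)².  After substituting q² for q,
-- the three cases only differ in how these products are written as q-Pochhammer symbols, and the
-- correction terms 2[λ admissible] q^{2λ} add up to geometric series.

{-# OPTIONS --safe #-}
module Submission where

open import Defs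
import Data.Bool.Properties as BoolP
open import Algebra.Bundles using (CommutativeRing)
open import Algebra.Structures using (IsCommutativeRing)
import Algebra.Properties.CommutativeSemigroup as CommSemigroupProperties
open import Algebra.Solver.Ring.AlmostCommutativeRing
  using (AlmostCommutativeRing; fromCommutativeRing; _-Raw-AlmostCommutative⟶_)
import Algebra.Solver.Ring
open import Algebra.Solver.CommutativeMonoid BoolP.∧-commutativeMonoid
  using (_⊜_) renaming (solve to ∧-solve; _⊕_ to _∧′_)
open import Data.Bool using (Bool; true; false; if_then_else_; _∧_; _∨_; not; T)
open import Data.Bool.Properties using (T?)
open import Data.Empty using (⊥-elim)
open import Data.Integer as ℤ using (ℤ; +_; -_; _+_; _*_; _-_)
import Data.Integer.Properties as ℤP
open import Data.Integer.Tactic.RingSolver using () renaming (solve-∀ to ℤ-solve-∀)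
open import Data.List using (List; []; _∷_; map; concatMap; filterᵇ; length; applyUpTo; _++_)
import Data.List.Properties as ListP
open import Data.Maybe using (Maybe)
import Data.Maybe as Maybe
open import Data.Nat as ℕ using (ℕ; zero; suc; _∸_; _≤_; _<_; z≤n; s≤s; _≡ᵇ_; _<ᵇ_; _≤ᵇ_)
import Data.Nat.Properties as ℕP
open import Data.Nat.Tactic.RingSolver using (solve-∀)
open import Data.Nat.ListAction using (sum)
import Data.Nat.ListAction.Properties as SumP
open import Data.Product using (_×_; _,_; proj₁; proj₂)
open import Data.Sum using (inj₁; inj₂)
open import Function using (_∘_)
open import Level using (0ℓ)
open import Relation.Binary.PropositionalEquality
  using (_≡_; refl; sym; trans; cong; cong₂; subst; module ≡-Reasoning)
open import Relation.Nullary.Decidable using (dec⇒maybe)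
import Relation.Binary.Reasoning.Setoid as SetoidReasoning

-- Finite sums and the Cauchy product

sumTo-cong : ∀ n {F G : ℕ → ℤ} → (∀ i → i ≤ n → F i ≡ G i) → sumTo n F ≡ sumTo n G
sumTo-cong zero    eq = eq 0 z≤n
sumTo-cong (suc n) eq =
  cong₂ _+_ (sumTo-cong n (λ i i≤n → eq i (ℕP.m≤n⇒m≤1+n i≤n))) (eq (suc n) ℕP.≤-refl)

sumTo-suc : ∀ n (F : ℕ → ℤ) → sumTo (suc n) F ≡ F 0 + sumTo n (F ∘ suc)
sumTo-suc zero    F = refl
sumTo-suc (suc n) F = begin
  sumTo (suc n) F + F (suc (suc n))           ≡⟨ cong (_+ F (suc (suc n))) (sumTo-suc n F) ⟩
  (F 0 + sumTo n (F ∘ suc)) + F (suc (suc n)) ≡⟨ ℤP.+-assoc (F 0) _ _ ⟩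
  F 0 + sumTo (suc n) (F ∘ suc)               ∎
  where open ≡-Reasoning

sumTo-+ : ∀ n (F G : ℕ → ℤ) → sumTo n (λ i → F i + G i) ≡ sumTo n F + sumTo n G
sumTo-+ zero    F G = refl
sumTo-+ (suc n) F G = trans (cong (_+ (F (suc n) + G (suc n))) (sumTo-+ n F G))
  (CommSemigroupProperties.interchange ℤP.+-commutativeSemigroup (sumTo n F) (sumTo n G) (F (suc n)) (G (suc n)))

sumTo-*ˡ : ∀ n c (F : ℕ → ℤ) → sumTo n (λ i → c * F i) ≡ c * sumTo n F
sumTo-*ˡ zero    c F = refl
sumTo-*ˡ (suc n) c F = trans (cong (_+ c * F (suc n)) (sumTo-*ˡ n c F))
  (sym (ℤP.*-distribˡ-+ c (sumTo n F) (F (suc n))))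

sumTo-zero : ∀ n → sumTo n (λ _ → + 0) ≡ + 0
sumTo-zero zero    = refl
sumTo-zero (suc n) = cong (_+ + 0) (sumTo-zero n)

⊗-suc : ∀ n (f g : Series) → (f ⊗ g) (suc n) ≡ f 0 * g (suc n) + ((f ∘ suc) ⊗ g) n
⊗-suc n f g = sumTo-suc n (λ i → f i * g (suc n ∸ i))

⊗-sucʳ : ∀ n (f g : Series) → (f ⊗ g) (suc n) ≡ (f ⊗ (g ∘ suc)) n + f (suc n) * g 0
⊗-sucʳ n f g = cong₂ _+_
  (sumTo-cong n (λ i i≤n → cong (λ k → f i * g k) (ℕP.+-∸-assoc 1 i≤n)))
  (cong (λ k → f (suc n) * g k) (ℕP.n∸n≡0 n))

⊗-congˡ : ∀ n {f f′} (g : Series) → (∀ i → i ≤ n → f i ≡ f′ i) → (f ⊗ g) n ≡ (f′ ⊗ g) n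
⊗-congˡ n g eq = sumTo-cong n (λ i i≤n → cong (_* g (n ∸ i)) (eq i i≤n))

⊗-congʳ : ∀ n (f : Series) {g g′} → (∀ i → i ≤ n → g i ≡ g′ i) → (f ⊗ g) n ≡ (f ⊗ g′) n
⊗-congʳ n f eq = sumTo-cong n (λ i _ → cong (f i *_) (eq (n ∸ i) (ℕP.m∸n≤m n i)))

⊗-comm : ∀ n (f g : Series) → (f ⊗ g) n ≡ (g ⊗ f) n
⊗-comm zero    f g = ℤP.*-comm (f 0) (g 0)
⊗-comm (suc n) f g = begin
  (f ⊗ g) (suc n)                       ≡⟨ ⊗-suc n f g ⟩
  f 0 * g (suc n) + ((f ∘ suc) ⊗ g) n   ≡⟨ cong₂ _+_ (ℤP.*-comm (f 0) _) (⊗-comm n (f ∘ suc) g) ⟩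
  g (suc n) * f 0 + (g ⊗ (f ∘ suc)) n   ≡⟨ ℤP.+-comm (g (suc n) * f 0) _ ⟩
  (g ⊗ (f ∘ suc)) n + g (suc n) * f 0   ≡⟨ sym (⊗-sucʳ n g f) ⟩
  (g ⊗ f) (suc n)                       ∎
  where open ≡-Reasoning

⊗-linearˡ : ∀ n c (f f′ g : Series) →
  ((λ i → c * f i + f′ i) ⊗ g) n ≡ c * (f ⊗ g) n + (f′ ⊗ g) n
⊗-linearˡ n c f f′ g = begin
  sumTo n (λ i → (c * f i + f′ i) * g (n ∸ i))
    ≡⟨ sumTo-cong n (λ i _ → trans (ℤP.*-distribʳ-+ (g (n ∸ i)) (c * f i) (f′ i))
                                   (cong (_+ f′ i * g (n ∸ i)) (ℤP.*-assoc c (f i) _))) ⟩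
  sumTo n (λ i → c * (f i * g (n ∸ i)) + f′ i * g (n ∸ i))
    ≡⟨ sumTo-+ n _ _ ⟩
  sumTo n (λ i → c * (f i * g (n ∸ i))) + (f′ ⊗ g) n
    ≡⟨ cong (_+ (f′ ⊗ g) n) (sumTo-*ˡ n c _) ⟩
  c * (f ⊗ g) n + (f′ ⊗ g) n ∎
  where open ≡-Reasoning

⊗-distribʳ-⊕ : ∀ n (f f′ g : Series) → ((f ⊕ f′) ⊗ g) n ≡ (f ⊗ g) n + (f′ ⊗ g) n
⊗-distribʳ-⊕ n f f′ g = trans (⊗-congˡ n g (λ i _ → cong (_+ f′ i) (sym (ℤP.*-identityˡ (f i)))))
  (trans (⊗-linearˡ n (+ 1) f f′ g) (cong (_+ (f′ ⊗ g) n) (ℤP.*-identityˡ ((f ⊗ g) n))))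

⊗-assoc : ∀ n (f g h : Series) → ((f ⊗ g) ⊗ h) n ≡ (f ⊗ (g ⊗ h)) n
⊗-assoc zero    f g h = ℤP.*-assoc (f 0) (g 0) (h 0)
⊗-assoc (suc n) f g h = begin
  ((f ⊗ g) ⊗ h) (suc n)
    ≡⟨ ⊗-suc n (f ⊗ g) h ⟩
  (f 0 * g 0) * h (suc n) + (((f ⊗ g) ∘ suc) ⊗ h) n
    ≡⟨ cong₂ _+_ (ℤP.*-assoc (f 0) (g 0) _)
         (trans (⊗-congˡ n h (λ i _ → ⊗-suc i f g)) (⊗-linearˡ n (f 0) (g ∘ suc) ((f ∘ suc) ⊗ g) h)) ⟩
  f 0 * (g 0 * h (suc n)) + (f 0 * ((g ∘ suc) ⊗ h) n + (((f ∘ suc) ⊗ g) ⊗ h) n)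
    ≡⟨ sym (ℤP.+-assoc (f 0 * (g 0 * h (suc n))) _ _) ⟩
  (f 0 * (g 0 * h (suc n)) + f 0 * ((g ∘ suc) ⊗ h) n) + (((f ∘ suc) ⊗ g) ⊗ h) n
    ≡⟨ cong₂ _+_ (trans (sym (ℤP.*-distribˡ-+ (f 0) _ _)) (cong (f 0 *_) (sym (⊗-suc n g h))))
                 (⊗-assoc n (f ∘ suc) g h) ⟩
  f 0 * (g ⊗ h) (suc n) + ((f ∘ suc) ⊗ (g ⊗ h)) n
    ≡⟨ sym (⊗-suc n f (g ⊗ h)) ⟩
  (f ⊗ (g ⊗ h)) (suc n) ∎
  where open ≡-Reasoning

⊗-zeroˡ : ∀ n (f : Series) → ((λ _ → + 0) ⊗ f) n ≡ + 0
⊗-zeroˡ n f = trans (sumTo-cong n (λ i _ → ℤP.*-zeroˡ (f (n ∸ i)))) (sumTo-zero n)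

const-⊗ : ∀ c (f : Series) n → (const c ⊗ f) n ≡ c * f n
const-⊗ c f zero    = refl
const-⊗ c f (suc n) = trans (⊗-suc n (const c) f)
  (trans (cong (λ x → c * f (suc n) + x) (⊗-zeroˡ n f)) (ℤP.+-identityʳ _))

shift : ℕ → Series → Series
shift zero    f n       = f n
shift (suc k) f zero    = + 0
shift (suc k) f (suc n) = shift k f n

qpow-⊗ : ∀ k n (f : Series) → (qpow k ⊗ f) n ≡ shift k f n
qpow-⊗ zero    n       f = trans (const-⊗ (+ 1) f n) (ℤP.*-identityˡ (f n))
qpow-⊗ (suc k) zero    f = ℤP.*-zeroˡ (f 0)
qpow-⊗ (suc k) (suc n) f = begin
  (qpow (suc k) ⊗ f) (suc n)          ≡⟨ ⊗-suc n (qpow (suc k)) f ⟩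
  + 0 * f (suc n) + (qpow k ⊗ f) n    ≡⟨ cong₂ _+_ (ℤP.*-zeroˡ (f (suc n))) (qpow-⊗ k n f) ⟩
  + 0 + shift k f n                   ≡⟨ ℤP.+-identityˡ _ ⟩
  shift (suc k) f (suc n)             ∎
  where open ≡-Reasoning

≤ᵇ≡<ᵇ-suc : ∀ m n → (m ≤ᵇ n) ≡ (m <ᵇ suc n)
≤ᵇ≡<ᵇ-suc zero    n = refl
≤ᵇ≡<ᵇ-suc (suc m) n = refl

shift-if : ∀ k f m → shift k f m ≡ (if k ≤ᵇ m then f (m ∸ k) else + 0)
shift-if zero    f m       = refl
shift-if (suc k) f zero    = refl
shift-if (suc k) f (suc m) =
  trans (shift-if k f m) (cong (λ b → if b then f (m ∸ k) else + 0) (≤ᵇ≡<ᵇ-suc k m))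

shift-qpow : ∀ a b n → shift a (qpow b) n ≡ qpow (a ℕ.+ b) n
shift-qpow zero    b n       = refl
shift-qpow (suc a) b zero    = refl
shift-qpow (suc a) b (suc n) = shift-qpow a b n

qpow⊗qpow : ∀ a b n → (qpow a ⊗ qpow b) n ≡ qpow (a ℕ.+ b) n
qpow⊗qpow a b n = trans (qpow-⊗ a n (qpow b)) (shift-qpow a b n)

shift-< : ∀ k (f : Series) n → n < k → shift k f n ≡ + 0
shift-< (suc k) f zero    _         = refl
shift-< (suc k) f (suc n) (s≤s n<k) = shift-< k f n n<k

-- Series modulo q^{N+1}, the setting for all identities involving poch a, which agrees with the finite
-- product prodTo a K only up to q^K.

record _≈[_]_ (f : Series) (N : ℕ) (g : Series) : Set where
  constructor mk≈
  field at : ∀ i → i ≤ N → f i ≡ g i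
open _≈[_]_ public

pointwise : ∀ {N f g} → (∀ i → f i ≡ g i) → f ≈[ N ] g
pointwise eq = mk≈ (λ i _ → eq i)

≡⇒≈ : ∀ {N f g} → f ≡ g → f ≈[ N ] g
≡⇒≈ refl = pointwise (λ _ → refl)

module Truncated (N : ℕ) where

  _≈_ : Series → Series → Set
  f ≈ g = f ≈[ N ] g

  ⊗-cong : ∀ {f f′ g g′} → f ≈ f′ → g ≈ g′ → (f ⊗ g) ≈ (f′ ⊗ g′)
  ⊗-cong {f} {f′} {g} {g′} f≈f′ g≈g′ = mk≈ λ i i≤N →
    trans (⊗-congˡ i g (λ j j≤i → at f≈f′ j (ℕP.≤-trans j≤i i≤N)))
          (⊗-congʳ i f′ (λ j j≤i → at g≈g′ j (ℕP.≤-trans j≤i i≤N)))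

  isCommutativeRing : IsCommutativeRing _≈_ _⊕_ _⊗_ (λ f i → - f i) (λ _ → + 0) 𝟙
  isCommutativeRing = record
    { isRing = record
      { +-isAbelianGroup = record
        { isGroup = record
          { isMonoid = record
            { isSemigroup = record
              { isMagma = record
                { isEquivalence = record
                  { refl  = mk≈ (λ _ _ → refl)
                  ; sym   = λ f≈g → mk≈ (λ i i≤N → sym (at f≈g i i≤N))
                  ; trans = λ f≈g g≈h → mk≈ (λ i i≤N → trans (at f≈g i i≤N) (at g≈h i i≤N)) }
                ; ∙-cong = λ f≈f′ g≈g′ → mk≈ (λ i i≤N → cong₂ _+_ (at f≈f′ i i≤N) (at g≈g′ i i≤N)) }
              ; assoc = λ f g h → pointwise (λ i → ℤP.+-assoc (f i) (g i) (h i)) }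
            ; identity = (λ f → pointwise (λ i → ℤP.+-identityˡ (f i)))
                       , (λ f → pointwise (λ i → ℤP.+-identityʳ (f i))) }
          ; inverse = (λ f → pointwise (λ i → ℤP.+-inverseˡ (f i)))
                    , (λ f → pointwise (λ i → ℤP.+-inverseʳ (f i)))
          ; ⁻¹-cong = λ f≈g → mk≈ (λ i i≤N → cong -_ (at f≈g i i≤N)) }
        ; comm = λ f g → pointwise (λ i → ℤP.+-comm (f i) (g i)) }
      ; *-cong = ⊗-cong
      ; *-assoc = λ f g h → pointwise (λ i → ⊗-assoc i f g h)
      ; *-identity = (λ f → pointwise (λ i → qpow-⊗ 0 i f))
                   , (λ f → pointwise (λ i → trans (⊗-comm i f 𝟙) (qpow-⊗ 0 i f)))
      ; distrib = (λ f g h → pointwise (λ i → trans (⊗-comm i f (g ⊕ h))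
                     (trans (⊗-distribʳ-⊕ i g h f) (cong₂ _+_ (⊗-comm i g f) (⊗-comm i h f)))))
                , (λ f g h → pointwise (λ i → ⊗-distribʳ-⊕ i g h f)) }
    ; *-comm = λ f g → pointwise (λ i → ⊗-comm i f g) }

  ⊖-cong : ∀ {f f′ g g′} → f ≈ f′ → g ≈ g′ → (f ⊖ g) ≈ (f′ ⊖ g′)
  ⊖-cong f≈f′ g≈g′ = mk≈ (λ i i≤N → cong₂ _-_ (at f≈f′ i i≤N) (at g≈g′ i i≤N))

  commutativeRing : CommutativeRing 0ℓ 0ℓ
  commutativeRing = record { isCommutativeRing = isCommutativeRing }

  open CommutativeRing commutativeRing public
    using (+-cong; -‿cong; setoid) renaming (refl to ≈-refl; sym to ≈-sym; trans to ≈-trans)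
  open SetoidReasoning setoid public

  private
    ring : AlmostCommutativeRing 0ℓ 0ℓ
    ring = fromCommutativeRing commutativeRing

    const-homomorphism : ℤ.+-*-rawRing -Raw-AlmostCommutative⟶ ring
    const-homomorphism = record
      { ⟦_⟧    = const
      ; +-homo = λ c d → pointwise (λ { zero → refl ; (suc i) → refl })
      ; *-homo = λ c d → pointwise (λ { zero → refl
                                      ; (suc i) → sym (trans (const-⊗ c (const d) (suc i)) (ℤP.*-zeroʳ c)) })
      ; -‿homo = λ c → pointwise (λ { zero → refl ; (suc i) → refl })
      ; 0-homo = pointwise (λ { zero → refl ; (suc i) → refl })
      ; 1-homo = pointwise (λ { zero → refl ; (suc i) → refl }) }

    const-≟ : ∀ c d → Maybe (const c ≈ const d)
    const-≟ c d = Maybe.map (λ c≡d → ≡⇒≈ (cong const c≡d)) (dec⇒maybe (c ℤ.≟ d))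

  open Algebra.Solver.Ring ℤ.+-*-rawRing ring const-homomorphism const-≟ public
    using (solve; _:=_; con; _:+_; _:*_; _:-_)

≡ᵇ-refl : ∀ n → (n ≡ᵇ n) ≡ true
≡ᵇ-refl zero    = refl
≡ᵇ-refl (suc n) = ≡ᵇ-refl n

≤⇒≡ᵇ-suc-false : ∀ {i n} → i ≤ n → (i ≡ᵇ suc n) ≡ false
≤⇒≡ᵇ-suc-false z≤n       = refl
≤⇒≡ᵇ-suc-false (s≤s i≤n) = ≤⇒≡ᵇ-suc-false i≤n

invUpTo-stable : ∀ f {n i} → i ≤ n → invUpTo f n i ≡ inv f i
invUpTo-stable f {n} {i} i≤n with ℕP.m≤n⇒m<n∨m≡n i≤n
... | inj₂ refl = refl
... | inj₁ (s≤s i≤n′) rewrite ≤⇒≡ᵇ-suc-false i≤n′ = invUpTo-stable f i≤n′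

inv-⊗ : ∀ f → f 0 ≡ + 1 → ∀ n → (inv f ⊗ f) n ≡ 𝟙 n
inv-⊗ f f₀≡1 zero    rewrite f₀≡1 = refl
inv-⊗ f f₀≡1 (suc m) = begin
  (inv f ⊗ f) (suc m)                          ≡⟨ ⊗-sucʳ m (inv f) f ⟩
  (inv f ⊗ (f ∘ suc)) m + inv f (suc m) * f 0  ≡⟨ cong₂ (λ x y → x + y * f 0) earlier last ⟩
  S + - S * f 0                                ≡⟨ cong (λ x → S + - S * x) f₀≡1 ⟩
  S + - S * + 1                                ≡⟨ cong (λ x → S + x) (ℤP.*-identityʳ (- S)) ⟩
  S + - S                                      ≡⟨ ℤP.+-inverseʳ S ⟩
  + 0                                          ∎
  where
  open ≡-Reasoning
  S = sumTo m (λ j → f (suc m ∸ j) * invUpTo f m j)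
  earlier : (inv f ⊗ (f ∘ suc)) m ≡ S
  earlier = sumTo-cong m (λ j j≤m → trans (ℤP.*-comm (inv f j) _)
    (cong₂ _*_ (cong f (sym (ℕP.+-∸-assoc 1 j≤m))) (sym (invUpTo-stable f j≤m))))
  last : inv f (suc m) ≡ - S
  last rewrite ≡ᵇ-refl m = refl

module _ {N : ℕ} where
  open Truncated N

  x⊗d≈y⇒y⊗inv-d≈x : ∀ x d y → d 0 ≡ + 1 → (x ⊗ d) ≈ y → (y ⊗ inv d) ≈ x
  x⊗d≈y⇒y⊗inv-d≈x x d y d₀≡1 x⊗d≈y = begin
    y ⊗ inv d          ≈⟨ ⊗-cong (≈-sym x⊗d≈y) (≈-refl {inv d}) ⟩
    (x ⊗ d) ⊗ inv d    ≈⟨ solve 3 (λ x d e → (x :* d) :* e := x :* (e :* d)) ≈-refl x d (inv d) ⟩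
    x ⊗ (inv d ⊗ d)    ≈⟨ ⊗-cong (≈-refl {x}) (pointwise (inv-⊗ d d₀≡1)) ⟩
    x ⊗ 𝟙              ≈⟨ solve 1 (λ x → x :* con (+ 1) := x) ≈-refl x ⟩
    x                  ∎

  ⊗-one-minus-qpow : ∀ f k → (f ⊗ (𝟙 ⊖ qpow k)) ≈ (λ i → f i - shift k f i)
  ⊗-one-minus-qpow f k = ≈-trans
    (solve 2 (λ f y → f :* (con (+ 1) :- y) := f :- y :* f) ≈-refl f (qpow k))
    (pointwise (λ i → cong (λ x → f i - x) (qpow-⊗ k i f)))

  -- Adjoining a part size whose power is y multiplies the generating function by (1 + y)/(1 - y).
  overpartition-step : ∀ a b b′ y → a ≈ (b ⊕ y ⊗ a) → b′ ≈ (b ⊕ (y ⊗ a ⊕ y ⊗ a)) →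
    (b′ ⊗ ((𝟙 ⊖ y) ⊗ (𝟙 ⊖ y))) ≈ (b ⊗ (𝟙 ⊖ y ⊗ y))
  overpartition-step a b b′ y a≈b+ya b′≈b+2ya = begin
    b′ ⊗ ((𝟙 ⊖ y) ⊗ (𝟙 ⊖ y))                                   ≈⟨ ⊗-cong b′≈b+2ya (≈-refl {(𝟙 ⊖ y) ⊗ (𝟙 ⊖ y)}) ⟩
    (b ⊕ (y ⊗ a ⊕ y ⊗ a)) ⊗ ((𝟙 ⊖ y) ⊗ (𝟙 ⊖ y))
      ≈⟨ ⊗-cong (+-cong b≈a[1-y] (≈-refl {y ⊗ a ⊕ y ⊗ a})) (≈-refl {(𝟙 ⊖ y) ⊗ (𝟙 ⊖ y)}) ⟩
    (a ⊗ (𝟙 ⊖ y) ⊕ (y ⊗ a ⊕ y ⊗ a)) ⊗ ((𝟙 ⊖ y) ⊗ (𝟙 ⊖ y))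
      ≈⟨ solve 2 (λ a y → (a :* (con (+ 1) :- y) :+ (y :* a :+ y :* a)) :* ((con (+ 1) :- y) :* (con (+ 1) :- y))
                          := (a :* (con (+ 1) :- y)) :* (con (+ 1) :- y :* y)) ≈-refl a y ⟩
    (a ⊗ (𝟙 ⊖ y)) ⊗ (𝟙 ⊖ y ⊗ y)                               ≈⟨ ⊗-cong (≈-sym b≈a[1-y]) (≈-refl {𝟙 ⊖ y ⊗ y}) ⟩
    b ⊗ (𝟙 ⊖ y ⊗ y)                                           ∎
    where
    b≈a[1-y] : b ≈ (a ⊗ (𝟙 ⊖ y))
    b≈a[1-y] = begin
      b                        ≈⟨ solve 2 (λ b z → b := (b :+ z) :- z) ≈-refl b (y ⊗ a) ⟩
      (b ⊕ y ⊗ a) ⊖ y ⊗ a      ≈⟨ +-cong (≈-sym a≈b+ya) (≈-refl {λ i → - (y ⊗ a) i}) ⟩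
      a ⊖ y ⊗ a                ≈⟨ solve 2 (λ a y → a :- y :* a := a :* (con (+ 1) :- y)) ≈-refl a y ⟩
      a ⊗ (𝟙 ⊖ y)              ∎

-- Infinite products

prodTo-suc : ∀ a m {i} → i < a ℕ.* suc m → prodTo a (suc m) i ≡ prodTo a m i
prodTo-suc a m {i} i<a[1+m] = begin
  (prodTo a m ⊗ (𝟙 ⊖ qpow (a ℕ.* suc m))) i ≡⟨ at (⊗-one-minus-qpow (prodTo a m) _) i ℕP.≤-refl ⟩
  prodTo a m i - shift (a ℕ.* suc m) (prodTo a m) i ≡⟨ cong (λ x → prodTo a m i - x) (shift-< _ _ i i<a[1+m]) ⟩
  prodTo a m i - + 0                        ≡⟨ ℤP.+-identityʳ _ ⟩
  prodTo a m i                              ∎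
  where open ≡-Reasoning

prodTo-stable : ∀ a .{{_ : ℕ.NonZero a}} {K i} → i ≤ K → prodTo a K i ≡ poch a i
prodTo-stable a {K} {i} i≤K with ℕP.m≤n⇒m<n∨m≡n i≤K
... | inj₂ refl = refl
... | inj₁ (s≤s {n = K′} i≤K′) =
  trans (prodTo-suc a K′ (ℕP.<-≤-trans (s≤s i≤K′) (ℕP.m≤n*m (suc K′) a))) (prodTo-stable a i≤K′)

poch≈prodTo : ∀ a .{{_ : ℕ.NonZero a}} {N K} → N ≤ K → poch a ≈[ N ] prodTo a K
poch≈prodTo a N≤K = mk≈ (λ i i≤N → sym (prodTo-stable a (ℕP.≤-trans i≤N N≤K)))

prodWhere : ℕ → (ℕ → Bool) → ℕ → Series
prodWhere a P zero    = 𝟙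
prodWhere a P (suc K) =
  if P (suc K) then prodWhere a P K ⊗ (𝟙 ⊖ qpow (a ℕ.* suc K)) else prodWhere a P K

prodWhere-all : ∀ a K → prodWhere a (λ _ → true) K ≡ prodTo a K
prodWhere-all a zero    = refl
prodWhere-all a (suc K) = cong (_⊗ (𝟙 ⊖ qpow (a ℕ.* suc K))) (prodWhere-all a K)

prodTo≈prodWhere⊗prodWhere-not : ∀ {N} a P K →
  prodTo a K ≈[ N ] (prodWhere a P K ⊗ prodWhere a (not ∘ P) K)
prodTo≈prodWhere⊗prodWhere-not {N} a P zero = solve 0 (con (+ 1) := con (+ 1) :* con (+ 1)) ≈-refl
  where open Truncated N
prodTo≈prodWhere⊗prodWhere-not {N} a P (suc K) with P (suc K)
... | true  = ≈-trans (⊗-cong (prodTo≈prodWhere⊗prodWhere-not a P K) (≈-refl {F}))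
                (solve 3 (λ x y z → (x :* y) :* z := (x :* z) :* y) ≈-refl Y N̄ F)
  where open Truncated N
        Y = prodWhere a P K
        N̄ = prodWhere a (not ∘ P) K
        F = 𝟙 ⊖ qpow (a ℕ.* suc K)
... | false = ≈-trans (⊗-cong (prodTo≈prodWhere⊗prodWhere-not a P K) (≈-refl {F}))
                (solve 3 (λ x y z → (x :* y) :* z := x :* (y :* z)) ≈-refl Y N̄ F)
  where open Truncated N
        Y = prodWhere a P K
        N̄ = prodWhere a (not ∘ P) K
        F = 𝟙 ⊖ qpow (a ℕ.* suc K)

double : ℕ → ℕ
double zero    = zero
double (suc n) = suc (suc (double n))

double≡2* : ∀ n → double n ≡ 2 ℕ.* n
double≡2* zero    = refl
double≡2* (suc n) = cong suc (trans (cong suc (double≡2* n)) (sym (ℕP.+-suc n (n ℕ.+ 0))))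

n≤double : ∀ n → n ≤ double n
n≤double zero    = z≤n
n≤double (suc n) = s≤s (ℕP.m≤n⇒m≤1+n (n≤double n))

prodWhere-evens : ∀ a (E : ℕ → Bool) →
  (∀ M → E (suc (double M)) ≡ false) → (∀ M → E (double (suc M)) ≡ true) →
  ∀ M → prodWhere a E (double M) ≡ prodTo (2 ℕ.* a) M
prodWhere-evens a E odd-out even-in zero = refl
prodWhere-evens a E odd-out even-in (suc M) rewrite even-in M | odd-out M =
  cong₂ (λ f k → f ⊗ (𝟙 ⊖ qpow k)) (prodWhere-evens a E odd-out even-in M) exponent
  where
  exponent : a ℕ.* suc (suc (double M)) ≡ 2 ℕ.* a ℕ.* suc M
  exponent = trans (cong (λ k → a ℕ.* suc (suc k)) (double≡2* M)) (identity a M)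
    where
    identity : ∀ a M → a ℕ.* suc (suc (2 ℕ.* M)) ≡ 2 ℕ.* a ℕ.* suc M
    identity = solve-∀

isOdd-double : ∀ M → isOdd (double M) ≡ false
isOdd-double zero    = refl
isOdd-double (suc M) = isOdd-double M

isOdd-suc-double : ∀ M → isOdd (suc (double M)) ≡ true
isOdd-suc-double zero    = refl
isOdd-suc-double (suc M) = isOdd-suc-double M

isEven-double : ∀ M → isEven (double M) ≡ true
isEven-double zero    = refl
isEven-double (suc M) = isEven-double M

isEven-suc-double : ∀ M → isEven (suc (double M)) ≡ false
isEven-suc-double zero    = refl
isEven-suc-double (suc M) = isEven-suc-double M

poch≈odd⊗poch-double : ∀ {N} a .{{_ : ℕ.NonZero a}} →
  poch a ≈[ N ] (prodWhere a isOdd (double N) ⊗ poch (2 ℕ.* a))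
poch≈odd⊗poch-double {N} a = begin
  poch a
    ≈⟨ poch≈prodTo a (n≤double N) ⟩
  prodTo a (double N)
    ≈⟨ prodTo≈prodWhere⊗prodWhere-not a isOdd (double N) ⟩
  prodWhere a isOdd (double N) ⊗ prodWhere a (not ∘ isOdd) (double N)
    ≈⟨ ≡⇒≈ (cong (prodWhere a isOdd (double N) ⊗_) (prodWhere-evens a (not ∘ isOdd)
         (cong not ∘ isOdd-suc-double) (cong not ∘ isOdd-double ∘ suc) N)) ⟩
  prodWhere a isOdd (double N) ⊗ prodTo (2 ℕ.* a) N
    ≈⟨ ⊗-cong (≈-refl {prodWhere a isOdd (double N)}) (≈-sym (poch≈prodTo (2 ℕ.* a) {{ℕP.m*n≢0 2 a}} ℕP.≤-refl)) ⟩
  prodWhere a isOdd (double N) ⊗ poch (2 ℕ.* a) ∎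
  where open Truncated N

-- Substituting q² for q

dilate : Series → Series
dilate g zero          = g 0
dilate g (suc zero)    = + 0
dilate g (suc (suc j)) = dilate (g ∘ suc) j

dilate-double : ∀ g l → dilate g (double l) ≡ g l
dilate-double g zero    = refl
dilate-double g (suc l) = dilate-double (g ∘ suc) l

dilate-odd : ∀ g l → dilate g (suc (double l)) ≡ + 0
dilate-odd g zero    = refl
dilate-odd g (suc l) = dilate-odd (g ∘ suc) l

dilate-cong : ∀ {N g h} → g ≈[ N ] h → dilate g ≈[ N ] dilate h
dilate-cong {N} {g} {h} g≈h = mk≈ (λ j j≤N → upTo j (λ m m≤j → at g≈h m (ℕP.≤-trans m≤j j≤N)))
  where
  upTo : ∀ j {g h} → (∀ m → m ≤ j → g m ≡ h m) → dilate g j ≡ dilate h j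
  upTo zero          eq = eq 0 z≤n
  upTo (suc zero)    eq = refl
  upTo (suc (suc j)) eq = upTo j (λ m m≤j → eq (suc m) (s≤s (ℕP.m≤n⇒m≤1+n m≤j)))

dilate-zipWith : ∀ (_∙_ : ℤ → ℤ → ℤ) → (+ 0) ∙ (+ 0) ≡ + 0 →
  ∀ g h j → dilate (λ m → g m ∙ h m) j ≡ dilate g j ∙ dilate h j
dilate-zipWith _∙_ 0∙0≡0 g h zero          = refl
dilate-zipWith _∙_ 0∙0≡0 g h (suc zero)    = sym 0∙0≡0
dilate-zipWith _∙_ 0∙0≡0 g h (suc (suc j)) = dilate-zipWith _∙_ 0∙0≡0 (g ∘ suc) (h ∘ suc) j

dilate-⊕ : ∀ {N} g h → dilate (g ⊕ h) ≈[ N ] (dilate g ⊕ dilate h)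
dilate-⊕ g h = pointwise (dilate-zipWith _+_ refl g h)

shift-dilate : ∀ t g j → shift (double t) (dilate g) j ≡ dilate (shift t g) j
shift-dilate zero    g j             = refl
shift-dilate (suc t) g zero          = refl
shift-dilate (suc t) g (suc zero)    = refl
shift-dilate (suc t) g (suc (suc j)) = shift-dilate t g j

dilate-shift : ∀ {N} t g → dilate (shift t g) ≈[ N ] (qpow (double t) ⊗ dilate g)
dilate-shift t g = pointwise (λ j → trans (sym (shift-dilate t g j)) (sym (qpow-⊗ (double t) j (dilate g))))

dilate-qpow : ∀ a j → dilate (qpow a) j ≡ qpow (double a) j
dilate-qpow zero    zero          = refl
dilate-qpow zero    (suc zero)    = refl
dilate-qpow zero    (suc (suc j)) = dilate-zero j
  where
  dilate-zero : ∀ j → dilate (λ _ → + 0) j ≡ + 0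
  dilate-zero zero          = refl
  dilate-zero (suc zero)    = refl
  dilate-zero (suc (suc j)) = dilate-zero j
dilate-qpow (suc a) zero          = refl
dilate-qpow (suc a) (suc zero)    = refl
dilate-qpow (suc a) (suc (suc j)) = dilate-qpow a j

dilate-geometric : ∀ {N} g p a → (∀ m → g m - shift p g m ≡ qpow a m) →
  (dilate g ⊗ (𝟙 ⊖ qpow (double p))) ≈[ N ] qpow (double a)
dilate-geometric {N} g p a g-recurrence = begin
  dilate g ⊗ (𝟙 ⊖ qpow (double p))                ≈⟨ ⊗-one-minus-qpow (dilate g) (double p) ⟩
  (λ j → dilate g j - shift (double p) (dilate g) j)
    ≈⟨ pointwise (λ j → cong (λ x → dilate g j - x) (shift-dilate p g j)) ⟩
  (λ j → dilate g j - dilate (shift p g) j)       ≈⟨ pointwise (λ j → sym (dilate-zipWith _-_ refl g (shift p g) j)) ⟩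
  dilate (λ m → g m - shift p g m)                ≈⟨ dilate-cong (pointwise g-recurrence) ⟩
  dilate (qpow a)                                 ≈⟨ pointwise (dilate-qpow a) ⟩
  qpow (double a)                                 ∎
  where open Truncated N

-- Counting lists in the pool of candidates

length-filterᵇ-∷ : ∀ {A : Set} (Q : A → Bool) x ys →
  length (filterᵇ Q (x ∷ ys)) ≡ (if Q x then 1 else 0) ℕ.+ length (filterᵇ Q ys)
length-filterᵇ-∷ Q x ys with Q x
... | true  = refl
... | false = refl

length-filterᵇ-cong : ∀ {A : Set} {Q Q′ : A → Bool} → (∀ x → Q x ≡ Q′ x) →
  ∀ ys → length (filterᵇ Q ys) ≡ length (filterᵇ Q′ ys)
length-filterᵇ-cong eq []       = refl
length-filterᵇ-cong {Q = Q} {Q′} eq (y ∷ ys) = begin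
  length (filterᵇ Q (y ∷ ys))                               ≡⟨ length-filterᵇ-∷ Q y ys ⟩
  (if Q y then 1 else 0) ℕ.+ length (filterᵇ Q ys)
    ≡⟨ cong₂ (λ b r → (if b then 1 else 0) ℕ.+ r) (eq y) (length-filterᵇ-cong eq ys) ⟩
  (if Q′ y then 1 else 0) ℕ.+ length (filterᵇ Q′ ys)        ≡⟨ sym (length-filterᵇ-∷ Q′ y ys) ⟩
  length (filterᵇ Q′ (y ∷ ys))                              ∎
  where open ≡-Reasoning

length-filterᵇ-map : ∀ {A B : Set} (Q : B → Bool) (f : A → B) ys →
  length (filterᵇ Q (map f ys)) ≡ length (filterᵇ (Q ∘ f) ys)
length-filterᵇ-map Q f []       = refl
length-filterᵇ-map Q f (y ∷ ys) = trans (length-filterᵇ-∷ Q (f y) (map f ys))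
  (trans (cong ((if Q (f y) then 1 else 0) ℕ.+_) (length-filterᵇ-map Q f ys))
         (sym (length-filterᵇ-∷ (Q ∘ f) y ys)))

length-filterᵇ-concatMap : ∀ {A B : Set} (Q : B → Bool) (f : A → List B) ys →
  length (filterᵇ Q (concatMap f ys)) ≡ sum (map (λ y → length (filterᵇ Q (f y))) ys)
length-filterᵇ-concatMap Q f []       = refl
length-filterᵇ-concatMap Q f (y ∷ ys) = begin
  length (filterᵇ Q (f y ++ concatMap f ys))
    ≡⟨ cong length (ListP.filter-++ (T? ∘ Q) (f y) (concatMap f ys)) ⟩
  length (filterᵇ Q (f y) ++ filterᵇ Q (concatMap f ys))
    ≡⟨ ListP.length-++ (filterᵇ Q (f y)) ⟩
  length (filterᵇ Q (f y)) ℕ.+ length (filterᵇ Q (concatMap f ys))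
    ≡⟨ cong (length (filterᵇ Q (f y)) ℕ.+_) (length-filterᵇ-concatMap Q f ys) ⟩
  sum (map (λ y → length (filterᵇ Q (f y))) (y ∷ ys)) ∎
  where open ≡-Reasoning

sum-map-cong : ∀ {A : Set} {f g : A → ℕ} → (∀ x → f x ≡ g x) → ∀ xs → sum (map f xs) ≡ sum (map g xs)
sum-map-cong eq xs = cong sum (ListP.map-cong eq xs)

module Pool {A : Set} (xs : List A) where

  count : ℕ → (List A → Bool) → ℕ
  count k Q = length (filterᵇ Q (listsUpTo k xs))

  count-suc : ∀ k Q →
    count (suc k) Q ≡ (if Q [] then 1 else 0) ℕ.+ sum (map (λ x → count k (Q ∘ (x ∷_))) xs)
  count-suc k Q = trans (length-filterᵇ-∷ Q [] _) (cong ((if Q [] then 1 else 0) ℕ.+_)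
    (trans (length-filterᵇ-concatMap Q (λ x → map (x ∷_) (listsUpTo k xs)) xs)
           (sum-map-cong (λ x → length-filterᵇ-map Q (x ∷_) (listsUpTo k xs)) xs)))

  count-cong : ∀ k {Q Q′} → (∀ μ → Q μ ≡ Q′ μ) → count k Q ≡ count k Q′
  count-cong k eq = length-filterᵇ-cong eq (listsUpTo k xs)

  count-∧ : ∀ k c Q → count k (λ μ → c ∧ Q μ) ≡ (if c then count k Q else 0)
  count-∧ k true  Q = refl
  count-∧ k false Q = false-none (listsUpTo k xs)
    where
    false-none : ∀ ys → length (filterᵇ (λ _ → false) ys) ≡ 0
    false-none []       = refl
    false-none (_ ∷ ys) = false-none ys

  count-fuel : ∀ {k k′} Q → k ≤ k′ → (∀ μ → T (Q μ) → length μ ≤ k) → count k′ Q ≡ count k Q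
  count-fuel {k} {k′} Q k≤k′ short with ℕP.m≤n⇒m<n∨m≡n k≤k′
  ... | inj₂ refl = refl
  ... | inj₁ (s≤s {n = k″} k≤k″) =
    trans (count-suc-fuel k″ Q (λ μ Qμ → ℕP.≤-trans (short μ Qμ) k≤k″)) (count-fuel Q k≤k″ short)
    where
    count-suc-fuel : ∀ k Q → (∀ μ → T (Q μ) → length μ ≤ k) → count (suc k) Q ≡ count k Q
    count-suc-fuel zero Q short = begin
      count 1 Q                                                  ≡⟨ count-suc 0 Q ⟩
      (if Q [] then 1 else 0) ℕ.+ sum (map (λ x → count 0 (Q ∘ (x ∷_))) xs)
        ≡⟨ cong ((if Q [] then 1 else 0) ℕ.+_) (trans (sum-map-cong singleton-rejected xs) (sum-zero xs)) ⟩
      (if Q [] then 1 else 0) ℕ.+ 0                               ≡⟨ sym (length-filterᵇ-∷ Q [] []) ⟩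
      count 0 Q                                                  ∎
      where
      open ≡-Reasoning
      singleton-rejected : ∀ x → count 0 (Q ∘ (x ∷_)) ≡ 0
      singleton-rejected x with Q (x ∷ []) in Q[x]
      ... | true  = ⊥-elim (ℕP.1+n≰n (short (x ∷ []) (subst T (sym Q[x]) _)))
      ... | false = refl
      sum-zero : ∀ (ys : List A) → sum (map (λ _ → 0) ys) ≡ 0
      sum-zero []       = refl
      sum-zero (_ ∷ ys) = sum-zero ys
    count-suc-fuel (suc k) Q short = begin
      count (suc (suc k)) Q                                        ≡⟨ count-suc (suc k) Q ⟩
      (if Q [] then 1 else 0) ℕ.+ sum (map (λ x → count (suc k) (Q ∘ (x ∷_))) xs)
        ≡⟨ cong ((if Q [] then 1 else 0) ℕ.+_) (sum-map-cong (λ x → count-suc-fuel k (Q ∘ (x ∷_))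
             (λ μ Qxμ → ℕP.≤-pred (short (x ∷ μ) Qxμ))) xs) ⟩
      (if Q [] then 1 else 0) ℕ.+ sum (map (λ x → count k (Q ∘ (x ∷_))) xs) ≡⟨ sym (count-suc k Q) ⟩
      count (suc k) Q                                              ∎
      where open ≡-Reasoning

sum-map-+ : ∀ {A : Set} (f g : A → ℕ) xs → sum (map (λ x → f x ℕ.+ g x) xs) ≡ sum (map f xs) ℕ.+ sum (map g xs)
sum-map-+ f g []       = refl
sum-map-+ f g (x ∷ xs) = trans (cong (f x ℕ.+ g x ℕ.+_) (sum-map-+ f g xs))
  (CommSemigroupProperties.interchange ℕP.+-commutativeSemigroup (f x) (g x) _ _)

sum-applyUpTo-cong : ∀ {F G : ℕ → ℕ} → (∀ i → F i ≡ G i) → ∀ n → sum (applyUpTo F n) ≡ sum (applyUpTo G n)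
sum-applyUpTo-cong eq zero    = refl
sum-applyUpTo-cong eq (suc n) = cong₂ ℕ._+_ (eq 0) (sum-applyUpTo-cong (eq ∘ suc) n)

sum-applyUpTo-zero : ∀ n → sum (applyUpTo (λ _ → 0) n) ≡ 0
sum-applyUpTo-zero zero    = refl
sum-applyUpTo-zero (suc n) = sum-applyUpTo-zero n

sum-applyUpTo-single : ∀ n t (F : ℕ → ℕ) → 1 ≤ t → (n < t → F t ≡ 0) →
  sum (applyUpTo (λ i → if t ≡ᵇ suc i then F (suc i) else 0) n) ≡ F t
sum-applyUpTo-single zero    t             F 1≤t vanish = sym (vanish 1≤t)
sum-applyUpTo-single (suc n) (suc zero)    F _ _      =
  trans (cong (F 1 ℕ.+_) (sum-applyUpTo-zero n)) (ℕP.+-identityʳ (F 1))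
sum-applyUpTo-single (suc n) (suc (suc t)) F _ vanish =
  sum-applyUpTo-single n (suc t) (F ∘ suc) (s≤s z≤n) (vanish ∘ s≤s)

sum-partsUpTo : ∀ n (g : Part → ℕ) →
  sum (map g (partsUpTo n)) ≡ sum (applyUpTo (λ i → g (suc i , true) ℕ.+ (g (suc i , false) ℕ.+ 0)) n)
sum-partsUpTo n g = begin
  sum (map g (concatMap pair (applyUpTo suc n)))           ≡⟨ concatMap-sum (applyUpTo suc n) ⟩
  sum (map (λ s → sum (map g (pair s))) (applyUpTo suc n)) ≡⟨ cong sum (ListP.map-applyUpTo suc _ n) ⟩
  sum (applyUpTo (λ i → g (suc i , true) ℕ.+ (g (suc i , false) ℕ.+ 0)) n) ∎
  where
  open ≡-Reasoning
  pair : ℕ → List Part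
  pair s = (s , true) ∷ (s , false) ∷ []
  concatMap-sum : ∀ ss → sum (map g (concatMap pair ss)) ≡ sum (map (λ s → sum (map g (pair s))) ss)
  concatMap-sum []       = refl
  concatMap-sum (s ∷ ss) = trans (cong sum (ListP.map-++ g (pair s) (concatMap pair ss)))
    (trans (SumP.sum-++ (map g (pair s)) (map g (concatMap pair ss)))
           (cong (sum (map g (pair s)) ℕ.+_) (concatMap-sum ss)))

sum-partsUpTo-cong : ∀ n {g h : Part → ℕ} → (∀ i o → g (suc i , o) ≡ h (suc i , o)) →
  sum (map g (partsUpTo n)) ≡ sum (map h (partsUpTo n))
sum-partsUpTo-cong n {g} {h} eq = trans (sum-partsUpTo n g)
  (trans (sum-applyUpTo-cong (λ i → cong₂ (λ x y → x ℕ.+ (y ℕ.+ 0)) (eq i true) (eq i false)) n)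
         (sym (sum-partsUpTo n h)))

module Parts (n : ℕ) where

  Σfirst : (ℕ → Bool → Bool) → (ℕ → ℕ) → ℕ
  Σfirst first F = sum (map (λ p → if first (proj₁ p) (proj₂ p) then F (proj₁ p) else 0) (partsUpTo n))

  Σfirst-∨ : ∀ first₁ first₂ F → (∀ s o → first₁ s o ∧ first₂ s o ≡ false) →
    Σfirst (λ s o → first₁ s o ∨ first₂ s o) F ≡ Σfirst first₁ F ℕ.+ Σfirst first₂ F
  Σfirst-∨ first₁ first₂ F disjoint = trans (sum-map-cong split (partsUpTo n)) (sum-map-+ _ _ (partsUpTo n))
    where
    split : ∀ p → (if first₁ (proj₁ p) (proj₂ p) ∨ first₂ (proj₁ p) (proj₂ p) then F (proj₁ p) else 0)
                ≡ (if first₁ (proj₁ p) (proj₂ p) then F (proj₁ p) else 0)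
                  ℕ.+ (if first₂ (proj₁ p) (proj₂ p) then F (proj₁ p) else 0)
    split (s , o) with first₁ s o | first₂ s o | disjoint s o
    ... | true  | false | _ = sym (ℕP.+-identityʳ (F s))
    ... | false | true  | _ = refl
    ... | false | false | _ = refl

  Σfirst-cong : ∀ first first′ F → (∀ i o → first (suc i) o ≡ first′ (suc i) o) →
    Σfirst first F ≡ Σfirst first′ F
  Σfirst-cong first first′ F eq =
    sum-partsUpTo-cong n (λ i o → cong (λ b → if b then F (suc i) else 0) (eq i o))

  Σfirst-none : ∀ F → Σfirst (λ _ _ → false) F ≡ 0
  Σfirst-none F = trans (sum-partsUpTo n _) (sum-applyUpTo-zero n)

  Σfirst-size : ∀ t F → 1 ≤ t → (n < t → F t ≡ 0) → Σfirst (λ s _ → t ≡ᵇ s) F ≡ 2 ℕ.* F t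
  Σfirst-size t F 1≤t vanish = begin
    Σfirst (λ s _ → t ≡ᵇ s) F
      ≡⟨ sum-partsUpTo n _ ⟩
    sum (applyUpTo (λ i → (if t ≡ᵇ suc i then F (suc i) else 0) ℕ.+ ((if t ≡ᵇ suc i then F (suc i) else 0) ℕ.+ 0)) n)
      ≡⟨ sum-applyUpTo-cong twice n ⟩
    sum (applyUpTo (λ i → if t ≡ᵇ suc i then 2 ℕ.* F (suc i) else 0) n)
      ≡⟨ sum-applyUpTo-single n t (λ s → 2 ℕ.* F s) 1≤t (cong (2 ℕ.*_) ∘ vanish) ⟩
    2 ℕ.* F t ∎
    where
    open ≡-Reasoning
    twice : ∀ i → (if t ≡ᵇ suc i then F (suc i) else 0) ℕ.+ ((if t ≡ᵇ suc i then F (suc i) else 0) ℕ.+ 0)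
                ≡ (if t ≡ᵇ suc i then 2 ℕ.* F (suc i) else 0)
    twice i with t ≡ᵇ suc i
    ... | true  = refl
    ... | false = refl

  Σfirst-part : ∀ t F → 1 ≤ t → (n < t → F t ≡ 0) → Σfirst (λ s o → (t ≡ᵇ s) ∧ not o) F ≡ F t
  Σfirst-part t F 1≤t vanish = begin
    Σfirst (λ s o → (t ≡ᵇ s) ∧ not o) F
      ≡⟨ sum-partsUpTo n _ ⟩
    sum (applyUpTo (λ i → (if (t ≡ᵇ suc i) ∧ false then F (suc i) else 0)
                          ℕ.+ ((if (t ≡ᵇ suc i) ∧ true then F (suc i) else 0) ℕ.+ 0)) n)
      ≡⟨ sum-applyUpTo-cong once n ⟩
    sum (applyUpTo (λ i → if t ≡ᵇ suc i then F (suc i) else 0) n)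
      ≡⟨ sum-applyUpTo-single n t F 1≤t vanish ⟩
    F t ∎
    where
    open ≡-Reasoning
    once : ∀ i → (if (t ≡ᵇ suc i) ∧ false then F (suc i) else 0)
                 ℕ.+ ((if (t ≡ᵇ suc i) ∧ true then F (suc i) else 0) ℕ.+ 0)
               ≡ (if t ≡ᵇ suc i then F (suc i) else 0)
    once i with t ≡ᵇ suc i
    ... | true  = ℕP.+-identityʳ (F (suc i))
    ... | false = refl

T-∧-split : ∀ a {b} → T (a ∧ b) → T a × T b
T-∧-split true t = _ , t

T-∧-intro : ∀ {a b} → T a → T b → T (a ∧ b)
T-∧-intro {true} _ tb = tb

n<ᵇ1+n : ∀ n → (n <ᵇ suc n) ≡ true
n<ᵇ1+n zero    = refl
n<ᵇ1+n (suc n) = n<ᵇ1+n n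

≤ᵇ-refl : ∀ n → (n ≤ᵇ n) ≡ true
≤ᵇ-refl zero    = refl
≤ᵇ-refl (suc n) = n<ᵇ1+n n

≤⇒<ᵇ-false : ∀ {m n} → m ≤ n → (n <ᵇ m) ≡ false
≤⇒<ᵇ-false z≤n       = refl
≤⇒<ᵇ-false (s≤s m≤n) = ≤⇒<ᵇ-false m≤n

<⇒≤ᵇ-false : ∀ {m n} → m < n → (n ≤ᵇ m) ≡ false
<⇒≤ᵇ-false (s≤s m≤n) = ≤⇒<ᵇ-false m≤n

<ᵇ-suc : ∀ s t → (s <ᵇ suc t) ≡ (s <ᵇ t) ∨ (t ≡ᵇ s)
<ᵇ-suc zero    zero    = refl
<ᵇ-suc zero    (suc t) = refl
<ᵇ-suc (suc s) zero    = refl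
<ᵇ-suc (suc s) (suc t) = <ᵇ-suc s t

<ᵇ-∧-≡ᵇ : ∀ s t → (s <ᵇ t) ∧ (t ≡ᵇ s) ≡ false
<ᵇ-∧-≡ᵇ zero    zero    = refl
<ᵇ-∧-≡ᵇ zero    (suc t) = refl
<ᵇ-∧-≡ᵇ (suc s) zero    = refl
<ᵇ-∧-≡ᵇ (suc s) (suc t) = <ᵇ-∧-≡ᵇ s t

≤ᵇ-∧-≡ᵇ-∸ : ∀ s x m → (s ≤ᵇ m) ∧ (x ≡ᵇ m ∸ s) ≡ (s ℕ.+ x ≡ᵇ m)
≤ᵇ-∧-≡ᵇ-∸ zero    x m       = refl
≤ᵇ-∧-≡ᵇ-∸ (suc s) x zero    = refl
≤ᵇ-∧-≡ᵇ-∸ (suc s) x (suc m) = trans (cong (_∧ (x ≡ᵇ m ∸ s)) (sym (≤ᵇ≡<ᵇ-suc s m))) (≤ᵇ-∧-≡ᵇ-∸ s x m)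

double-≡ᵇ : ∀ s t → (s ℕ.+ s ≡ᵇ double t) ≡ (t ≡ᵇ s)
double-≡ᵇ zero    zero    = refl
double-≡ᵇ zero    (suc t) = refl
double-≡ᵇ (suc s) zero    = refl
double-≡ᵇ (suc s) (suc t) rewrite ℕP.+-suc s s = double-≡ᵇ s t

double-≡ᵇ-odd : ∀ s t → (s ℕ.+ s ≡ᵇ suc (double t)) ≡ false
double-≡ᵇ-odd zero    t       = refl
double-≡ᵇ-odd (suc s) zero    rewrite ℕP.+-suc s s = refl
double-≡ᵇ-odd (suc s) (suc t) rewrite ℕP.+-suc s s = double-≡ᵇ-odd s t

∧-absorb : ∀ {a b c} → (T a → T b → T c) → (a ∧ b) ∧ c ≡ a ∧ b
∧-absorb {true}  {true}  {c} a∧b⇒c with c | a∧b⇒c _ _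
... | true | _ = refl
∧-absorb {true}  {false} _     = refl
∧-absorb {false}         _     = refl

∧-congʳ-under : ∀ {a b c} → (T a → b ≡ c) → a ∧ b ≡ a ∧ c
∧-congʳ-under {true}  b≡c = b≡c _
∧-congʳ-under {false} _   = refl

all-∧ : ∀ {A : Set} (f g : A → Bool) xs → all (λ x → f x ∧ g x) xs ≡ all f xs ∧ all g xs
all-∧ f g []       = refl
all-∧ f g (x ∷ xs) = trans (cong ((f x ∧ g x) ∧_) (all-∧ f g xs))
  (∧-solve 4 (λ a b c d → (a ∧′ b) ∧′ (c ∧′ d) ⊜ (a ∧′ c) ∧′ (b ∧′ d)) refl (f x) (g x) (all f xs) (all g xs))

-- Overpartitions into admissible parts

follows : ℕ → ℕ → Bool → Bool
follows t s o = (s <ᵇ t) ∨ ((t ≡ᵇ s) ∧ not o)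

follows⇒≤ : ∀ t s o → T (follows t s o) → s ≤ t
follows⇒≤ t s o h with s <ᵇ t in s<t
... | true  = ℕP.<⇒≤ (ℕP.<ᵇ⇒< s t (subst T (sym s<t) _))
... | false = ℕP.≤-reflexive (sym (ℕP.≡ᵇ⇒≡ t s (proj₁ (T-∧-split (t ≡ᵇ s) h))))

wellOrdered-∷ : ∀ s o μ → wellOrdered ((s , o) ∷ μ) ≡ wellOrdered ((s , false) ∷ μ)
wellOrdered-∷ s o []      = refl
wellOrdered-∷ s o (_ ∷ _) = refl

wellOrdered-<ᵇ : ∀ {b} s o μ → T (s <ᵇ b) → T (wellOrdered ((s , o) ∷ μ)) → T (all (λ p → proj₁ p <ᵇ b) μ)
wellOrdered-<ᵇ s o []               _   _  = _
wellOrdered-<ᵇ {b} s o ((s′ , o′) ∷ μ) s<b wo =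
  let (s′-follows , wo′) = T-∧-split (follows s s′ o′) wo
      s′<b : T (s′ <ᵇ b)
      s′<b = ℕP.<⇒<ᵇ (ℕP.≤-<-trans (follows⇒≤ s s′ o′ s′-follows) (ℕP.<ᵇ⇒< s b s<b))
  in T-∧-intro {s′ <ᵇ b} s′<b (wellOrdered-<ᵇ {b} s′ o′ μ s′<b wo′)

module Overpartitions (P : ℕ → Bool) (n : ℕ) where
  open Pool (partsUpTo n)
  open Parts n

  admissible : ℕ → Bool
  admissible s = (1 ≤ᵇ s) ∧ P s

  headed : (ℕ → Bool → Bool) → ℕ → List Part → Bool
  headed first m []             = 0 ≡ᵇ m
  headed first m ((s , o) ∷ μ) = first s o ∧ ((s ≤ᵇ m) ∧ admissible s) ∧ headed (follows s) (m ∸ s) μ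

  #headed : (ℕ → Bool → Bool) → ℕ → ℕ
  #headed first m = count m (headed first m)

  #after #below : ℕ → ℕ → ℕ
  #after t = #headed (follows t)
  #below b = #headed (λ s _ → s <ᵇ b)

  #leading : ℕ → ℕ → ℕ
  #leading t m = if (t ≤ᵇ m) ∧ admissible t then #after t (m ∸ t) else 0

  headed-length : ∀ first m μ → T (headed first m μ) → length μ ≤ m
  headed-length first m []             _ = z≤n
  headed-length first m ((s , o) ∷ μ) h =
    let (_ , h₁)      = T-∧-split (first s o) h
        (h₂ , rest)   = T-∧-split ((s ≤ᵇ m) ∧ admissible s) h₁
        (s≤m , h₃)    = T-∧-split (s ≤ᵇ m) h₂
        (1≤s , _)     = T-∧-split (1 ≤ᵇ s) h₃
    in ℕP.≤-trans (s≤s (headed-length (follows s) (m ∸ s) μ rest))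
                  (ℕP.∸-monoʳ-< (ℕP.≤ᵇ⇒≤ 1 s 1≤s) (ℕP.≤ᵇ⇒≤ s m s≤m))

  #headed-suc : ∀ first m → #headed first (suc m) ≡ Σfirst first (λ s → #leading s (suc m))
  #headed-suc first m = trans (count-suc m (headed first (suc m))) (sum-partsUpTo-cong n byFirstPart)
    where
    byFirstPart : ∀ s o → count m (headed first (suc m) ∘ ((suc s , o) ∷_))
                        ≡ (if first (suc s) o then #leading (suc s) (suc m) else 0)
    byFirstPart s o = trans (count-∧ m (first (suc s) o) _)
      (cong (λ x → if first (suc s) o then x else 0) (trans (count-∧ m _ _)
        (cong (λ x → if (suc s ≤ᵇ suc m) ∧ admissible (suc s) then x else 0)
          (count-fuel (headed (follows (suc s)) (m ∸ s)) (ℕP.m∸n≤m m s) (headed-length _ _)))))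

  #leading-beyond : ∀ {t m} → m < t → #leading t m ≡ 0
  #leading-beyond {t} {m} m<t rewrite <⇒≤ᵇ-false m<t = refl

  #leading-diagonal : ∀ t → #leading t t ≡ (if admissible t then 1 else 0)
  #leading-diagonal t rewrite ≤ᵇ-refl t | ℕP.n∸n≡0 t = refl

  #after≡#below+#leading : ∀ t m → 1 ≤ t → m ≤ n → #after t m ≡ #below t m ℕ.+ #leading t m
  #after≡#below+#leading (suc t) zero    _   _    = refl
  #after≡#below+#leading t       (suc m) 1≤t m<n = begin
    #after t (suc m)                                    ≡⟨ #headed-suc (follows t) m ⟩
    Σfirst (follows t) F
      ≡⟨ Σfirst-∨ (λ s _ → s <ᵇ t) (λ s o → (t ≡ᵇ s) ∧ not o) F
           (λ s o → trans (sym (BoolP.∧-assoc (s <ᵇ t) _ _)) (cong (_∧ not o) (<ᵇ-∧-≡ᵇ s t))) ⟩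
    Σfirst (λ s _ → s <ᵇ t) F ℕ.+ Σfirst (λ s o → (t ≡ᵇ s) ∧ not o) F
      ≡⟨ cong₂ ℕ._+_ (sym (#headed-suc _ m)) (Σfirst-part t F 1≤t (#leading-beyond {t} ∘ ℕP.≤-<-trans m<n)) ⟩
    #below t (suc m) ℕ.+ #leading t (suc m)             ∎
    where
    open ≡-Reasoning
    F = λ s → #leading s (suc m)

  #below-suc : ∀ t m → 1 ≤ t → m ≤ n → #below (suc t) m ≡ #below t m ℕ.+ 2 ℕ.* #leading t m
  #below-suc (suc t) zero    _   _    = refl
  #below-suc t       (suc m) 1≤t m<n = begin
    #below (suc t) (suc m)
      ≡⟨ #headed-suc _ m ⟩
    Σfirst (λ s _ → s <ᵇ suc t) F
      ≡⟨ Σfirst-cong (λ s _ → s <ᵇ suc t) (λ s _ → (s <ᵇ t) ∨ (t ≡ᵇ s)) F (λ i _ → <ᵇ-suc (suc i) t) ⟩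
    Σfirst (λ s _ → (s <ᵇ t) ∨ (t ≡ᵇ s)) F
      ≡⟨ Σfirst-∨ (λ s _ → s <ᵇ t) (λ s _ → t ≡ᵇ s) F (λ s _ → <ᵇ-∧-≡ᵇ s t) ⟩
    Σfirst (λ s _ → s <ᵇ t) F ℕ.+ Σfirst (λ s _ → t ≡ᵇ s) F
      ≡⟨ cong₂ ℕ._+_ (sym (#headed-suc _ m)) (Σfirst-size t F 1≤t (#leading-beyond {t} ∘ ℕP.≤-<-trans m<n)) ⟩
    #below t (suc m) ℕ.+ 2 ℕ.* #leading t (suc m)         ∎
    where
    open ≡-Reasoning
    F = λ s → #leading s (suc m)

  #below-one : ∀ m → #below 1 m ≡ (if m ≡ᵇ 0 then 1 else 0)
  #below-one zero    = refl
  #below-one (suc m) = trans (#headed-suc _ m)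
    (trans (Σfirst-cong (λ s _ → s <ᵇ 1) (λ _ _ → false) F (λ _ _ → refl)) (Σfirst-none F))
    where F = λ s → #leading s (suc m)

  -- Parts larger than the weight cannot occur.
  #below-beyond : ∀ t K → 1 ≤ t → t ≤ K → t ≤ n → #below (suc K) t ≡ #below t t ℕ.+ 2 ℕ.* #leading t t
  #below-beyond t K 1≤t t≤K t≤n with ℕP.m≤n⇒m<n∨m≡n t≤K
  ... | inj₂ refl = #below-suc t t 1≤t t≤n
  ... | inj₁ (s≤s {n = K′} t≤K′) = begin
    #below (suc (suc K′)) t                            ≡⟨ #below-suc (suc K′) t (s≤s z≤n) t≤n ⟩
    #below (suc K′) t ℕ.+ 2 ℕ.* #leading (suc K′) t
      ≡⟨ cong (λ x → #below (suc K′) t ℕ.+ 2 ℕ.* x) (#leading-beyond (s≤s t≤K′)) ⟩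
    #below (suc K′) t ℕ.+ 0                            ≡⟨ ℕP.+-identityʳ _ ⟩
    #below (suc K′) t                                  ≡⟨ #below-beyond t K′ 1≤t t≤K′ t≤n ⟩
    #below t t ℕ.+ 2 ℕ.* #leading t t                  ∎
    where open ≡-Reasoning

  𝔸 𝔹 : ℕ → Series
  𝔸 t m = + #after t m
  𝔹 b m = + #below b m

  leading≡shift : ∀ t → P (suc t) ≡ true → ∀ m → + #leading (suc t) m ≡ shift (suc t) (𝔸 (suc t)) m
  leading≡shift t Pt m rewrite shift-if (suc t) (𝔸 (suc t)) m | Pt with t <ᵇ m
  ... | true  = refl
  ... | false = refl

  module _ where
    open Truncated n

    𝔸-recurrence : ∀ t → P (suc t) ≡ true → 𝔸 (suc t) ≈ (𝔹 (suc t) ⊕ shift (suc t) (𝔸 (suc t)))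
    𝔸-recurrence t Pt = mk≈ λ m m≤n →
      trans (cong +_ (#after≡#below+#leading (suc t) m (s≤s z≤n) m≤n))
            (trans (ℤP.pos-+ (#below (suc t) m) _) (cong (λ x → + #below (suc t) m + x) (leading≡shift t Pt m)))

    𝔹-recurrence : ∀ t → P (suc t) ≡ true →
      𝔹 (suc (suc t)) ≈ (𝔹 (suc t) ⊕ (shift (suc t) (𝔸 (suc t)) ⊕ shift (suc t) (𝔸 (suc t))))
    𝔹-recurrence t Pt = mk≈ λ m m≤n →
      trans (cong +_ (trans (#below-suc (suc t) m (s≤s z≤n) m≤n)
                            (cong (λ x → #below (suc t) m ℕ.+ (#leading (suc t) m ℕ.+ x))
                                  (ℕP.+-identityʳ (#leading (suc t) m)))))
            (trans (ℤP.pos-+ (#below (suc t) m) _) (cong (λ x → + #below (suc t) m + x)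
              (trans (ℤP.pos-+ (#leading (suc t) m) _) (cong₂ _+_ (leading≡shift t Pt m) (leading≡shift t Pt m)))))

    𝔹-skip : ∀ t → P (suc t) ≡ false → 𝔹 (suc (suc t)) ≈ 𝔹 (suc t)
    𝔹-skip t ¬Pt = mk≈ λ m m≤n → cong +_ (trans (#below-suc (suc t) m (s≤s z≤n) m≤n)
      (trans (cong (λ x → #below (suc t) m ℕ.+ 2 ℕ.* x) (not-leading m)) (ℕP.+-identityʳ _)))
      where
      not-leading : ∀ m → #leading (suc t) m ≡ 0
      not-leading m rewrite ¬Pt | BoolP.∧-zeroʳ (t <ᵇ m) = refl

    dilate-𝔸-recurrence : ∀ t → P (suc t) ≡ true →
      dilate (𝔸 (suc t)) ≈ (dilate (𝔹 (suc t)) ⊕ qpow (double (suc t)) ⊗ dilate (𝔸 (suc t)))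
    dilate-𝔸-recurrence t Pt = ≈-trans (dilate-cong (𝔸-recurrence t Pt))
      (≈-trans (dilate-⊕ _ _) (+-cong (≈-refl {dilate (𝔹 (suc t))}) (dilate-shift (suc t) (𝔸 (suc t)))))

    dilate-𝔹-recurrence : ∀ t → P (suc t) ≡ true →
      let y = qpow (double (suc t)) in
      dilate (𝔹 (suc (suc t))) ≈ (dilate (𝔹 (suc t)) ⊕ (y ⊗ dilate (𝔸 (suc t)) ⊕ y ⊗ dilate (𝔸 (suc t))))
    dilate-𝔹-recurrence t Pt = ≈-trans (dilate-cong (𝔹-recurrence t Pt))
      (≈-trans (dilate-⊕ _ _) (+-cong (≈-refl {dilate (𝔹 (suc t))})
        (≈-trans (dilate-⊕ _ _) (+-cong (dilate-shift (suc t) (𝔸 (suc t))) (dilate-shift (suc t) (𝔸 (suc t)))))))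

    product-formula : ∀ K → (dilate (𝔹 (suc K)) ⊗ (prodWhere 2 P K ⊗ prodWhere 2 P K)) ≈ prodWhere 4 P K
    product-formula zero = begin
      dilate (𝔹 1) ⊗ (𝟙 ⊗ 𝟙) ≈⟨ solve 1 (λ b → b :* (con (+ 1) :* con (+ 1)) := b) ≈-refl (dilate (𝔹 1)) ⟩
      dilate (𝔹 1)           ≈⟨ dilate-cong (pointwise 𝔹₁≡𝟙) ⟩
      dilate 𝟙               ≈⟨ pointwise (dilate-qpow 0) ⟩
      𝟙                      ∎
      where
      𝔹₁≡𝟙 : ∀ m → 𝔹 1 m ≡ 𝟙 m
      𝔹₁≡𝟙 m rewrite #below-one m with m ≡ᵇ 0
      ... | true  = refl
      ... | false = refl
    product-formula (suc t) with P (suc t) in Pt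
    ... | false = ≈-trans (⊗-cong (dilate-cong (𝔹-skip t Pt)) (≈-refl {Q ⊗ Q})) (product-formula t)
      where Q = prodWhere 2 P t
    ... | true  = begin
      B′ ⊗ ((Q ⊗ (𝟙 ⊖ qpow (2 ℕ.* suc t))) ⊗ (Q ⊗ (𝟙 ⊖ qpow (2 ℕ.* suc t))))
        ≈⟨ ≡⇒≈ (cong (λ k → B′ ⊗ ((Q ⊗ (𝟙 ⊖ qpow k)) ⊗ (Q ⊗ (𝟙 ⊖ qpow k)))) (sym (double≡2* (suc t)))) ⟩
      B′ ⊗ ((Q ⊗ (𝟙 ⊖ y)) ⊗ (Q ⊗ (𝟙 ⊖ y)))
        ≈⟨ solve 3 (λ b q y → b :* ((q :* (con (+ 1) :- y)) :* (q :* (con (+ 1) :- y)))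
                              := (b :* ((con (+ 1) :- y) :* (con (+ 1) :- y))) :* (q :* q)) ≈-refl B′ Q y ⟩
      (B′ ⊗ ((𝟙 ⊖ y) ⊗ (𝟙 ⊖ y))) ⊗ (Q ⊗ Q)
        ≈⟨ ⊗-cong (overpartition-step (dilate (𝔸 (suc t))) B B′ y
                    (dilate-𝔸-recurrence t Pt) (dilate-𝔹-recurrence t Pt)) (≈-refl {Q ⊗ Q}) ⟩
      (B ⊗ (𝟙 ⊖ y ⊗ y)) ⊗ (Q ⊗ Q)
        ≈⟨ solve 3 (λ b q z → (b :* (con (+ 1) :- z)) :* (q :* q) := (b :* (q :* q)) :* (con (+ 1) :- z))
                   ≈-refl B Q (y ⊗ y) ⟩
      (B ⊗ (Q ⊗ Q)) ⊗ (𝟙 ⊖ y ⊗ y)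
        ≈⟨ ⊗-cong (product-formula t) (+-cong (≈-refl {𝟙}) (-‿cong y²)) ⟩
      prodWhere 4 P t ⊗ (𝟙 ⊖ qpow (4 ℕ.* suc t)) ∎
      where
      B = dilate (𝔹 (suc t))
      B′ = dilate (𝔹 (suc (suc t)))
      Q = prodWhere 2 P t
      y = qpow (double (suc t))
      y² : (y ⊗ y) ≈ qpow (4 ℕ.* suc t)
      y² = pointwise λ i → trans (qpow⊗qpow (double (suc t)) (double (suc t)) i)
        (cong (λ k → qpow k i) (trans (cong₂ ℕ._+_ (double≡2* (suc t)) (double≡2* (suc t))) (four (suc t))))
        where
        four : ∀ s → 2 ℕ.* s ℕ.+ 2 ℕ.* s ≡ 4 ℕ.* s
        four = solve-∀

  headed-follows : ∀ t m μ → headed (follows t) m μ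
    ≡ wellOrdered ((t , false) ∷ μ) ∧ all (admissible ∘ proj₁) μ ∧ (sum (sizes μ) ≡ᵇ m)
  headed-follows t m []             = refl
  headed-follows t m ((s , o) ∷ μ) = begin
    follows t s o ∧ ((s ≤ᵇ m) ∧ admissible s) ∧ headed (follows s) (m ∸ s) μ
      ≡⟨ cong (λ h → follows t s o ∧ ((s ≤ᵇ m) ∧ admissible s) ∧ h) (headed-follows s (m ∸ s) μ) ⟩
    follows t s o ∧ ((s ≤ᵇ m) ∧ admissible s) ∧ W ∧ A ∧ (Σμ ≡ᵇ m ∸ s)
      ≡⟨ ∧-solve 6 (λ f l a w as e → f ∧′ ((l ∧′ a) ∧′ (w ∧′ (as ∧′ e))) ⊜ (f ∧′ w) ∧′ ((a ∧′ as) ∧′ (l ∧′ e)))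
                   refl (follows t s o) (s ≤ᵇ m) (admissible s) W A (Σμ ≡ᵇ m ∸ s) ⟩
    (follows t s o ∧ W) ∧ (admissible s ∧ A) ∧ ((s ≤ᵇ m) ∧ (Σμ ≡ᵇ m ∸ s))
      ≡⟨ cong₂ (λ w e → (follows t s o ∧ w) ∧ (admissible s ∧ A) ∧ e) (sym (wellOrdered-∷ s o μ)) (≤ᵇ-∧-≡ᵇ-∸ s Σμ m) ⟩
    (follows t s o ∧ wellOrdered ((s , o) ∷ μ)) ∧ (admissible s ∧ A) ∧ (s ℕ.+ Σμ ≡ᵇ m) ∎
    where
    open ≡-Reasoning
    W = wellOrdered ((s , false) ∷ μ)
    A = all (admissible ∘ proj₁) μ
    Σμ = sum (sizes μ)

  headed-below : ∀ b m μ → headed (λ s _ → s <ᵇ b) m μ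
    ≡ all (λ p → proj₁ p <ᵇ b) μ ∧ wellOrdered μ ∧ all (admissible ∘ proj₁) μ ∧ (sum (sizes μ) ≡ᵇ m)
  headed-below b m []             = refl
  headed-below b m ((s , o) ∷ μ) = begin
    (s <ᵇ b) ∧ ((s ≤ᵇ m) ∧ admissible s) ∧ headed (follows s) (m ∸ s) μ
      ≡⟨ cong (λ h → (s <ᵇ b) ∧ ((s ≤ᵇ m) ∧ admissible s) ∧ h) (headed-follows s (m ∸ s) μ) ⟩
    (s <ᵇ b) ∧ ((s ≤ᵇ m) ∧ admissible s) ∧ W ∧ A ∧ (Σμ ≡ᵇ m ∸ s)
      ≡⟨ ∧-solve 6 (λ x l a w as e → x ∧′ ((l ∧′ a) ∧′ (w ∧′ (as ∧′ e))) ⊜ (x ∧′ w) ∧′ ((a ∧′ as) ∧′ (l ∧′ e)))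
                   refl (s <ᵇ b) (s ≤ᵇ m) (admissible s) W A (Σμ ≡ᵇ m ∸ s) ⟩
    ((s <ᵇ b) ∧ W) ∧ (admissible s ∧ A) ∧ ((s ≤ᵇ m) ∧ (Σμ ≡ᵇ m ∸ s))
      ≡⟨ cong (_∧ ((admissible s ∧ A) ∧ ((s ≤ᵇ m) ∧ (Σμ ≡ᵇ m ∸ s))))
              (sym (∧-absorb {s <ᵇ b} {W} {Lt} (wellOrdered-<ᵇ {b} s false μ))) ⟩
    (((s <ᵇ b) ∧ W) ∧ Lt) ∧ (admissible s ∧ A) ∧ ((s ≤ᵇ m) ∧ (Σμ ≡ᵇ m ∸ s))
      ≡⟨ ∧-solve 6 (λ x w lt aa l e → ((x ∧′ w) ∧′ lt) ∧′ (aa ∧′ (l ∧′ e)) ⊜ (x ∧′ lt) ∧′ (w ∧′ (aa ∧′ (l ∧′ e))))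
                   refl (s <ᵇ b) W Lt (admissible s ∧ A) (s ≤ᵇ m) (Σμ ≡ᵇ m ∸ s) ⟩
    ((s <ᵇ b) ∧ Lt) ∧ W ∧ (admissible s ∧ A) ∧ ((s ≤ᵇ m) ∧ (Σμ ≡ᵇ m ∸ s))
      ≡⟨ cong₂ (λ w e → ((s <ᵇ b) ∧ Lt) ∧ w ∧ (admissible s ∧ A) ∧ e) (sym (wellOrdered-∷ s o μ)) (≤ᵇ-∧-≡ᵇ-∸ s Σμ m) ⟩
    ((s <ᵇ b) ∧ Lt) ∧ wellOrdered ((s , o) ∷ μ) ∧ (admissible s ∧ A) ∧ (s ℕ.+ Σμ ≡ᵇ m) ∎
    where
    open ≡-Reasoning
    W = wellOrdered ((s , false) ∷ μ)
    A = all (admissible ∘ proj₁) μ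
    Lt = all (λ p → proj₁ p <ᵇ b) μ
    Σμ = sum (sizes μ)

  𝕀 : Series
  𝕀 m = + (if admissible m then 1 else 0)

  -- Any bound above n would do; 2n is even, as the splitting of products by parity requires.
  ρ-series : Series
  ρ-series = dilate (𝔹 (suc (double n))) ⊖ const (+ 2) ⊗ dilate 𝕀 ⊖ 𝟙

  module ρ (R : ℕ → List Part → Bool)
           (R-spec : ∀ s μ → R s μ ≡ isOverpartitionOf s μ ∧ all (P ∘ proj₁) μ) where

    isRhoObject-∷ : ∀ i μ → isRhoObject R n ((suc i , false) ∷ μ)
                          ≡ (suc i ℕ.+ suc i ≡ᵇ n) ∧ headed (λ s _ → s <ᵇ suc i) (suc i) μ
    isRhoObject-∷ i μ = begin
      Lt ∧ R S μ ∧ (S ℕ.+ Σμ ≡ᵇ n)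
        ≡⟨ cong (λ r → Lt ∧ r ∧ (S ℕ.+ Σμ ≡ᵇ n)) (R-spec S μ) ⟩
      Lt ∧ (((Σμ ≡ᵇ S) ∧ Pos ∧ W) ∧ AP) ∧ (S ℕ.+ Σμ ≡ᵇ n)
        ≡⟨ ∧-solve 6 (λ lt e pos w ap n₁ → lt ∧′ (((e ∧′ (pos ∧′ w)) ∧′ ap) ∧′ n₁)
                                           ⊜ lt ∧′ (w ∧′ ((pos ∧′ ap) ∧′ (e ∧′ n₁))))
                     refl Lt (Σμ ≡ᵇ S) Pos W AP (S ℕ.+ Σμ ≡ᵇ n) ⟩
      Lt ∧ W ∧ (Pos ∧ AP) ∧ ((Σμ ≡ᵇ S) ∧ (S ℕ.+ Σμ ≡ᵇ n))
        ≡⟨ cong₂ (λ a x → Lt ∧ W ∧ a ∧ x) (sym (all-∧ _ _ μ))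
                 (∧-congʳ-under (λ Σμ≡S → cong (λ x → S ℕ.+ x ≡ᵇ n) (ℕP.≡ᵇ⇒≡ Σμ S Σμ≡S))) ⟩
      Lt ∧ W ∧ Adm ∧ ((Σμ ≡ᵇ S) ∧ (S ℕ.+ S ≡ᵇ n))
        ≡⟨ ∧-solve 5 (λ lt w a e n₂ → lt ∧′ (w ∧′ (a ∧′ (e ∧′ n₂))) ⊜ n₂ ∧′ (lt ∧′ (w ∧′ (a ∧′ e))))
                     refl Lt W Adm (Σμ ≡ᵇ S) (S ℕ.+ S ≡ᵇ n) ⟩
      (S ℕ.+ S ≡ᵇ n) ∧ Lt ∧ W ∧ Adm ∧ (Σμ ≡ᵇ S)
        ≡⟨ cong ((S ℕ.+ S ≡ᵇ n) ∧_) (sym (headed-below S S μ)) ⟩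
      (S ℕ.+ S ≡ᵇ n) ∧ headed (λ s _ → s <ᵇ S) S μ ∎
      where
      open ≡-Reasoning
      S = suc i
      Σμ = sum (sizes μ)
      Lt = all (λ p → proj₁ p <ᵇ S) μ
      Pos = all (λ p → 1 ≤ᵇ proj₁ p) μ
      W = wellOrdered μ
      AP = all (P ∘ proj₁) μ
      Adm = all (admissible ∘ proj₁) μ

    halving : ℕ → Bool → Bool
    halving s o = not o ∧ (s ℕ.+ s ≡ᵇ n)

    #diagonal : ℕ → ℕ
    #diagonal s = #below s s

    countRho-Σfirst : ∀ {n′} → n ≡ suc n′ → countRho R n ≡ Σfirst halving #diagonal
    countRho-Σfirst {n′} n≡1+n′ = begin
      count n (isRhoObject R n)                                 ≡⟨ cong (λ k → count k (isRhoObject R n)) n≡1+n′ ⟩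
      count (suc n′) (isRhoObject R n)                          ≡⟨ count-suc n′ (isRhoObject R n) ⟩
      sum (map (λ p → count n′ (isRhoObject R n ∘ (p ∷_))) (partsUpTo n)) ≡⟨ sum-partsUpTo-cong n byFirstPart ⟩
      Σfirst halving #diagonal ∎
      where
      open ≡-Reasoning
      byFirstPart : ∀ i o → count n′ (isRhoObject R n ∘ ((suc i , o) ∷_))
                          ≡ (if not o ∧ (suc i ℕ.+ suc i ≡ᵇ n) then #below (suc i) (suc i) else 0)
      byFirstPart i true  = count-∧ n′ false (λ _ → true)
      byFirstPart i false = trans (count-cong n′ (isRhoObject-∷ i)) (trans (count-∧ n′ _ _) refuel)
        where
        refuel : (if suc i ℕ.+ suc i ≡ᵇ n then count n′ (headed (λ s _ → s <ᵇ suc i) (suc i)) else 0)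
               ≡ (if suc i ℕ.+ suc i ≡ᵇ n then #below (suc i) (suc i) else 0)
        refuel with suc i ℕ.+ suc i ≡ᵇ n in 2S≡n
        ... | false = refl
        ... | true  = count-fuel _ S≤n′ (headed-length _ _)
          where
          S≤n′ : suc i ≤ n′
          S≤n′ = subst (suc i ≤_)
            (ℕP.suc-injective (trans (ℕP.≡ᵇ⇒≡ _ n (subst T (sym 2S≡n) _)) n≡1+n′)) (ℕP.m≤n+m (suc i) i)

    countRho-even : ∀ l → n ≡ double (suc l) → countRho R n ≡ #below (suc l) (suc l)
    countRho-even l n≡2[1+l] = trans (countRho-Σfirst n≡2[1+l])
      (trans (Σfirst-cong halving (λ s o → (suc l ≡ᵇ s) ∧ not o) #diagonal halves)
             (Σfirst-part (suc l) #diagonal (s≤s z≤n) (λ n<1+l → ⊥-elim (ℕP.<⇒≱ n<1+l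
                (subst (suc l ≤_) (sym n≡2[1+l]) (n≤double (suc l)))))))
      where
      halves : ∀ i o → not o ∧ (suc i ℕ.+ suc i ≡ᵇ n) ≡ (suc l ≡ᵇ suc i) ∧ not o
      halves i o = trans (cong (λ k → not o ∧ (suc i ℕ.+ suc i ≡ᵇ k)) n≡2[1+l])
        (trans (cong (not o ∧_) (double-≡ᵇ (suc i) (suc l))) (BoolP.∧-comm (not o) _))

    countRho-odd : ∀ l → n ≡ suc (double l) → countRho R n ≡ 0
    countRho-odd l n≡1+2l = trans (countRho-Σfirst n≡1+2l)
      (trans (Σfirst-cong halving (λ _ _ → false) #diagonal no-halves) (Σfirst-none #diagonal))
      where
      no-halves : ∀ i o → not o ∧ (suc i ℕ.+ suc i ≡ᵇ n) ≡ false
      no-halves i o = trans (cong (λ k → not o ∧ (suc i ℕ.+ suc i ≡ᵇ k)) n≡1+2l)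
        (trans (cong (not o ∧_) (double-≡ᵇ-odd (suc i) l)) (BoolP.∧-zeroʳ (not o)))

-- The generating functions

data Parity : ℕ → Set where
  even : ∀ l → Parity (double l)
  odd  : ∀ l → Parity (suc (double l))

parity : ∀ n → Parity n
parity zero = even 0
parity (suc n) with parity n
... | even l = odd l
... | odd  l = even (suc l)

gf-countRho : ∀ P R → (∀ s μ → R s μ ≡ isOverpartitionOf s μ ∧ all (P ∘ proj₁) μ) →
  ∀ n → + countRho R n ≡ Overpartitions.ρ-series P n n
gf-countRho P R R-spec n with parity n
... | even zero    = refl
... | odd l        = trans (cong +_ (countRho-odd l refl))
  (sym (cong₂ (λ x y → x - y - + 0) (dilate-odd (𝔹 (suc (double (suc (double l))))) l)
              (trans (const-⊗ (+ 2) (dilate 𝕀) (suc (double l))) (cong (+ 2 *_) (dilate-odd 𝕀 l)))))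
  where open Overpartitions P (suc (double l))
        open ρ R R-spec
... | even (suc l) = begin
  + countRho R N
    ≡⟨ cong +_ (countRho-even l refl) ⟩
  + #below S S
    ≡⟨ sym (cancel (#below S S) (if admissible S then 1 else 0)) ⟩
  + (#below S S ℕ.+ 2 ℕ.* (if admissible S then 1 else 0)) - + 2 * 𝕀 S - + 0
    ≡⟨ cong (λ b → + b - + 2 * 𝕀 S - + 0) (sym (trans
         (#below-beyond S (double N) (s≤s z≤n) (ℕP.≤-trans S≤N (n≤double N)) S≤N)
         (cong (λ x → #below S S ℕ.+ 2 ℕ.* x) (#leading-diagonal S)))) ⟩
  + #below (suc (double N)) S - + 2 * 𝕀 S - + 0
    ≡⟨ sym (cong₂ (λ x y → x - y - + 0) (dilate-double (𝔹 (suc (double N))) S)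
                  (trans (const-⊗ (+ 2) (dilate 𝕀) N) (cong (+ 2 *_) (dilate-double 𝕀 S)))) ⟩
  ρ-series N ∎
  where
  open ≡-Reasoning
  N = double (suc l)
  S = suc l
  open Overpartitions P N
  open ρ R R-spec
  S≤N : S ≤ N
  S≤N = n≤double S
  cancel : ∀ b c → + (b ℕ.+ 2 ℕ.* c) - + 2 * + c - + 0 ≡ + b
  cancel b c = trans (cong (λ z → z - + 2 * + c - + 0)
                           (trans (ℤP.pos-+ b (2 ℕ.* c)) (cong (λ z → + b + z) (ℤP.pos-* 2 c))))
                     (identity (+ b) (+ c))
    where
    identity : ∀ x y → x + + 2 * y - + 2 * y - + 0 ≡ x
    identity = ℤ-solve-∀

overpartition-spec : ∀ s μ → isOverpartitionOf s μ ≡ isOverpartitionOf s μ ∧ all ((λ _ → true) ∘ proj₁) μ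
overpartition-spec s μ = sym (trans (cong (isOverpartitionOf s μ ∧_) (all-true μ)) (BoolP.∧-identityʳ _))
  where
  all-true : ∀ (μ : List Part) → all (λ _ → true) μ ≡ true
  all-true []      = refl
  all-true (_ ∷ μ) = all-true μ

module _ (n : ℕ) where
  open Truncated n

  ρ̄-series : Overpartitions.ρ-series (λ _ → true) n
    ≈ (poch 4 ⊗ inv (poch 2 ⊗ poch 2) ⊖ const (+ 2) ⊗ inv (𝟙 ⊖ qpow 2) ⊕ 𝟙)
  ρ̄-series = ≈-sym (begin
    poch 4 ⊗ inv (poch 2 ⊗ poch 2) ⊖ const (+ 2) ⊗ inv (𝟙 ⊖ qpow 2) ⊕ 𝟙
      ≈⟨ +-cong (⊖-cong X≈OP (⊗-cong (≈-refl {const (+ 2)}) G≈D+1)) (≈-refl {𝟙}) ⟩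
    OP ⊖ const (+ 2) ⊗ (D ⊕ 𝟙) ⊕ 𝟙
      ≈⟨ solve 2 (λ op d → op :- con (+ 2) :* (d :+ con (+ 1)) :+ con (+ 1) := op :- con (+ 2) :* d :- con (+ 1))
               ≈-refl OP D ⟩
    OP ⊖ const (+ 2) ⊗ D ⊖ 𝟙 ∎)
    where
    open Overpartitions (λ _ → true) n
    K = double n
    OP = dilate (𝔹 (suc K))
    D = dilate 𝕀
    X≈OP : (poch 4 ⊗ inv (poch 2 ⊗ poch 2)) ≈ OP
    X≈OP = x⊗d≈y⇒y⊗inv-d≈x OP (poch 2 ⊗ poch 2) (poch 4) refl (begin
      OP ⊗ (poch 2 ⊗ poch 2)                  ≈⟨ ⊗-cong (≈-refl {OP}) (⊗-cong P₂≈ P₂≈) ⟩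
      OP ⊗ (prodTo 2 K ⊗ prodTo 2 K)          ≈⟨ ≡⇒≈ (cong (λ f → OP ⊗ (f ⊗ f)) (sym (prodWhere-all 2 K))) ⟩
      OP ⊗ (prodWhere 2 (λ _ → true) K ⊗ prodWhere 2 (λ _ → true) K) ≈⟨ product-formula K ⟩
      prodWhere 4 (λ _ → true) K               ≈⟨ ≡⇒≈ (prodWhere-all 4 K) ⟩
      prodTo 4 K                               ≈⟨ ≈-sym (poch≈prodTo 4 (n≤double n)) ⟩
      poch 4                                   ∎)
      where
      P₂≈ : poch 2 ≈ prodTo 2 K
      P₂≈ = poch≈prodTo 2 (n≤double n)
    G≈D+1 : inv (𝟙 ⊖ qpow 2) ≈ (D ⊕ 𝟙)
    G≈D+1 = ≈-trans (solve 1 (λ g → g := con (+ 1) :* g) ≈-refl (inv (𝟙 ⊖ qpow 2)))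
      (x⊗d≈y⇒y⊗inv-d≈x (D ⊕ 𝟙) (𝟙 ⊖ qpow 2) 𝟙 refl (begin
        (D ⊕ 𝟙) ⊗ (𝟙 ⊖ qpow 2)
          ≈⟨ solve 2 (λ d y → (d :+ con (+ 1)) :* (con (+ 1) :- y) := d :* (con (+ 1) :- y) :+ (con (+ 1) :- y))
                     ≈-refl D (qpow 2) ⟩
        D ⊗ (𝟙 ⊖ qpow 2) ⊕ (𝟙 ⊖ qpow 2)     ≈⟨ +-cong (dilate-geometric 𝕀 1 1 𝕀-recurrence) (≈-refl {𝟙 ⊖ qpow 2}) ⟩
        qpow 2 ⊕ (𝟙 ⊖ qpow 2)               ≈⟨ solve 1 (λ y → y :+ (con (+ 1) :- y) := con (+ 1)) ≈-refl (qpow 2) ⟩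
        𝟙                                   ∎))
      where
      𝕀-recurrence : ∀ m → 𝕀 m - shift 1 𝕀 m ≡ qpow 1 m
      𝕀-recurrence zero          = refl
      𝕀-recurrence (suc zero)    = refl
      𝕀-recurrence (suc (suc m)) = refl

  ρ̄ₒ-series : Overpartitions.ρ-series isOdd n
    ≈ (poch 4 ⊗ poch 4 ⊗ poch 4 ⊗ inv (poch 2 ⊗ poch 2 ⊗ poch 8) ⊖ const (+ 2) ⊗ qpow 2 ⊗ inv (𝟙 ⊖ qpow 4) ⊖ 𝟙)
  ρ̄ₒ-series = ≈-sym (⊖-cong (⊖-cong X≈OP (≈-trans
    (solve 3 (λ c y g → (c :* y) :* g := c :* (y :* g)) ≈-refl (const (+ 2)) (qpow 2) (inv (𝟙 ⊖ qpow 4)))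
    (⊗-cong (≈-refl {const (+ 2)}) G≈D))) (≈-refl {𝟙}))
    where
    open Overpartitions isOdd n
    K = double n
    OP = dilate (𝔹 (suc K))
    Q = prodWhere 2 isOdd K
    R = prodWhere 4 isOdd K
    P₂ = poch 2
    P₄ = poch 4
    P₈ = poch 8
    X≈OP : (P₄ ⊗ P₄ ⊗ P₄ ⊗ inv (P₂ ⊗ P₂ ⊗ P₈)) ≈ OP
    X≈OP = x⊗d≈y⇒y⊗inv-d≈x OP (P₂ ⊗ P₂ ⊗ P₈) (P₄ ⊗ P₄ ⊗ P₄) refl (begin
      OP ⊗ ((P₂ ⊗ P₂) ⊗ P₈)
        ≈⟨ ⊗-cong (≈-refl {OP}) (⊗-cong (⊗-cong (poch≈odd⊗poch-double 2) (poch≈odd⊗poch-double 2)) (≈-refl {P₈})) ⟩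
      OP ⊗ (((Q ⊗ P₄) ⊗ (Q ⊗ P₄)) ⊗ P₈)
        ≈⟨ solve 4 (λ b q p e → b :* (((q :* p) :* (q :* p)) :* e) := (b :* (q :* q)) :* ((p :* p) :* e))
                   ≈-refl OP Q P₄ P₈ ⟩
      (OP ⊗ (Q ⊗ Q)) ⊗ ((P₄ ⊗ P₄) ⊗ P₈)  ≈⟨ ⊗-cong (product-formula K) (≈-refl {(P₄ ⊗ P₄) ⊗ P₈}) ⟩
      R ⊗ ((P₄ ⊗ P₄) ⊗ P₈)
        ≈⟨ solve 3 (λ r p e → r :* ((p :* p) :* e) := (p :* p) :* (r :* e)) ≈-refl R P₄ P₈ ⟩
      (P₄ ⊗ P₄) ⊗ (R ⊗ P₈)               ≈⟨ ⊗-cong (≈-refl {P₄ ⊗ P₄}) (≈-sym (poch≈odd⊗poch-double 4)) ⟩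
      (P₄ ⊗ P₄) ⊗ P₄                     ∎)
    G≈D : (qpow 2 ⊗ inv (𝟙 ⊖ qpow 4)) ≈ dilate 𝕀
    G≈D = x⊗d≈y⇒y⊗inv-d≈x (dilate 𝕀) (𝟙 ⊖ qpow 4) (qpow 2) refl (dilate-geometric 𝕀 2 1 𝕀-recurrence)
      where
      𝕀-recurrence : ∀ m → 𝕀 m - shift 2 𝕀 m ≡ qpow 1 m
      𝕀-recurrence 0                   = refl
      𝕀-recurrence 1                   = refl
      𝕀-recurrence 2                   = refl
      𝕀-recurrence (suc (suc (suc m))) = ℤP.+-inverseʳ (𝕀 (suc m))

  ρ̄ₑ-series : Overpartitions.ρ-series isEven n
    ≈ (poch 8 ⊗ inv (poch 4 ⊗ poch 4) ⊖ const (+ 2) ⊗ qpow 4 ⊗ inv (𝟙 ⊖ qpow 4) ⊖ 𝟙)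
  ρ̄ₑ-series = ≈-sym (⊖-cong (⊖-cong X≈OP (≈-trans
    (solve 3 (λ c y g → (c :* y) :* g := c :* (y :* g)) ≈-refl (const (+ 2)) (qpow 4) (inv (𝟙 ⊖ qpow 4)))
    (⊗-cong (≈-refl {const (+ 2)}) G≈D))) (≈-refl {𝟙}))
    where
    open Overpartitions isEven n
    K = double n
    OP = dilate (𝔹 (suc K))
    evens : ∀ a → prodWhere a isEven K ≡ prodTo (2 ℕ.* a) n
    evens a = prodWhere-evens a isEven isEven-suc-double (isEven-double ∘ suc) n
    X≈OP : (poch 8 ⊗ inv (poch 4 ⊗ poch 4)) ≈ OP
    X≈OP = x⊗d≈y⇒y⊗inv-d≈x OP (poch 4 ⊗ poch 4) (poch 8) refl (begin
      OP ⊗ (poch 4 ⊗ poch 4)                  ≈⟨ ⊗-cong (≈-refl {OP}) (⊗-cong P₄≈ P₄≈) ⟩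
      OP ⊗ (prodTo 4 n ⊗ prodTo 4 n)          ≈⟨ ≡⇒≈ (cong (λ f → OP ⊗ (f ⊗ f)) (sym (evens 2))) ⟩
      OP ⊗ (prodWhere 2 isEven K ⊗ prodWhere 2 isEven K) ≈⟨ product-formula K ⟩
      prodWhere 4 isEven K                     ≈⟨ ≡⇒≈ (evens 4) ⟩
      prodTo 8 n                               ≈⟨ ≈-sym (poch≈prodTo 8 ℕP.≤-refl) ⟩
      poch 8                                   ∎)
      where
      P₄≈ : poch 4 ≈ prodTo 4 n
      P₄≈ = poch≈prodTo 4 ℕP.≤-refl
    G≈D : (qpow 4 ⊗ inv (𝟙 ⊖ qpow 4)) ≈ dilate 𝕀
    G≈D = x⊗d≈y⇒y⊗inv-d≈x (dilate 𝕀) (𝟙 ⊖ qpow 4) (qpow 4) refl (dilate-geometric 𝕀 2 2 𝕀-recurrence)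
      where
      𝕀-recurrence : ∀ m → 𝕀 m - shift 2 𝕀 m ≡ qpow 2 m
      𝕀-recurrence 0                         = refl
      𝕀-recurrence 1                         = refl
      𝕀-recurrence 2                         = refl
      𝕀-recurrence 3                         = refl
      𝕀-recurrence (suc (suc (suc (suc m)))) = ℤP.+-inverseʳ (𝕀 (suc (suc m)))

theorem1p2 : (n : ℕ)
    → (gf ρ̄ n ≡ (poch 4 ⊗ inv (poch 2 ⊗ poch 2)
                   ⊖ const (+ 2) ⊗ inv (𝟙 ⊖ qpow 2) ⊕ 𝟙) n)
    × (gf ρ̄ₒ n ≡ (poch 4 ⊗ poch 4 ⊗ poch 4 ⊗ inv (poch 2 ⊗ poch 2 ⊗ poch 8)
                   ⊖ const (+ 2) ⊗ qpow 2 ⊗ inv (𝟙 ⊖ qpow 4) ⊖ 𝟙) n)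
    × (gf ρ̄ₑ n ≡ (poch 8 ⊗ inv (poch 4 ⊗ poch 4)
                   ⊖ const (+ 2) ⊗ qpow 4 ⊗ inv (𝟙 ⊖ qpow 4) ⊖ 𝟙) n)
theorem1p2 n =
    trans (gf-countRho (λ _ → true) isOverpartitionOf overpartition-spec n) (at (ρ̄-series n) n ℕP.≤-refl)
  , trans (gf-countRho isOdd isOddOverpartitionOf (λ _ _ → refl) n) (at (ρ̄ₒ-series n) n ℕP.≤-refl)
  , trans (gf-countRho isEven isEvenOverpartitionOf (λ _ _ → refl) n) (at (ρ̄ₑ-series n) n ℕP.≤-refl)
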